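{- If $D$ is a diagram that contains no ghost cells, then $\widehat{\mathrm{MaxG}}(D)=\widehat{\mathrm{sf}}(D)$.
   Context: A diagram is a finite set of cells at positions $(r,c)$ with $r,c$ positive integers ($r$ = row from the bottom, $c$ = column), at most one cell per position; each cell is either ordinary, written $(r,c)$, or a ghost cell, written $\langle r,c\rangle$. A position is empty if it contains no cell. Ghost move at row $r$ of $D$: let the rightmost cell of row $r$ (ghost or not) lie in column $c$. The move does nothing if that cell is a ghost cell, or every position $(r',c)$ with $r'<r$ is occupied, or, letting $\hat r<r$ be maximal with $(\hat r,c)$ empty, some $(r^*,c)$ with $\hat r<r^*<r$ holds a ghost cell. Otherwise it moves the cell from $(r,c)$ to $(\hat r,c)$ and places a ghost cell $\langle r,c\rangle$ at $(r,c)$. $GKD(D)$ is the set of $D$ and all diagrams obtained from $D$ by finite sequences of ghost moves; $\widehat{\mathrm{MaxG}}(D)$ is the maximum number of ghost cells in a diagram of $GKD(D)$. Construction of $\widehat{\mathsf{snow}}(D)$ for $D$ without ghost cells: let the nonempty columns be $c_1<\dots<c_m$, $R_i=\{r:(r,c_i)\in D\}$ and $F_i=\{r\in R_i: r\in\bigcup_{j=i+1}^m R_j\}$ (rows in which the cell in column $c_i$ is not rightmost). Label cells: every cell of column $c_m$ gets label $1$. For $i\in[m-1]$: each cell $(r,c_i)$ with $r\in F_i$ gets label $r$; then, processing $r\in R_i\setminus F_i$ in decreasing order, the cell $(r,c_i)$ gets as label the maximal $r^*\in\bigcup_{j=i+1}^m R_j$ with $r^*<r$ that is not already the label of a cell of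 column $c_i$, or label $1$ if no such $r^*$ exists. Then an empty position $(r,c)$ lying strictly below some cell of $D$ in column $c$ receives a snowflake iff there is a cell $(\tilde r,c)\in D$ with $\tilde r>r$ whose label is $\le r$. $\widehat{\mathrm{sf}}(D)$ is the number of snowflakes. -}

module Defs where

open import Data.Bool using (Bool; true; false; _∧_; _∨_; not; if_then_else_)
open import Data.Nat using (ℕ; zero; suc; _+_; _∸_; _≤_; _⊔_; _≡ᵇ_; _<ᵇ_; _≤ᵇ_)
open import Data.List using (List; []; _∷_; map; filter; length; foldl; foldr; downFrom; upTo; concatMap)
open import Data.Bool.ListAction using (any)
open import Data.List.Membership.Propositional using (_∈_)
open import Data.List.Relation.Unary.All using (All)
open import Data.List.Relation.Unary.Unique.Propositional using (Unique)
open import Data.Maybe using (Maybe; just; nothing; maybe)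
open import Data.Product using (_×_; _,_; proj₁; proj₂; ∃)
open import Relation.Binary.PropositionalEquality using (_≡_)
open import Relation.Binary.Construct.Closure.ReflexiveTransitive using (Star)
open import Relation.Nullary.Decidable using (T?)
open import Data.Bool using (T)

data Kind : Set where
  ord ghost : Kind

isGhostK : Kind → Bool
isGhostK ord   = false
isGhostK ghost = true

-- a cell: (row r from the bottom, column c, kind)
record Cell : Set where
  constructor cell
  field
    row  : ℕ
    col  : ℕ
    kind : Kind
open Cell public

Diagram : Set
Diagram = List Cell

WellFormed : Diagram → Set
WellFormed D =
  All (λ x → 1 ≤ row x × 1 ≤ col x) D × Unique (map (λ x → row x , col x) D)

NoGhost : Diagram → Set
NoGhost D = All (λ x → kind x ≡ ord) D

samePos : ℕ → ℕ → Cell → Bool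
samePos r c x = (row x ≡ᵇ r) ∧ (col x ≡ᵇ c)

at : Diagram → ℕ → ℕ → Maybe Kind
at []      r c = nothing
at (x ∷ D) r c = if samePos r c x then just (kind x) else at D r c

isEmpty : Diagram → ℕ → ℕ → Bool
isEmpty D r c = maybe (λ _ → false) true (at D r c)

isGhostAt : Diagram → ℕ → ℕ → Bool
isGhostAt D r c = maybe isGhostK false (at D r c)

ghosts : Diagram → ℕ
ghosts D = length (filter (λ x → T? (isGhostK (kind x))) D)

rightmost : Diagram → ℕ → Maybe (ℕ × Kind)
rightmost []      r = nothing
rightmost (x ∷ D) r with rightmost D r | row x ≡ᵇ r
... | m         | false = m
... | nothing   | true  = just (col x , kind x)
... | just (c , k) | true = if c <ᵇ col x then just (col x , kind x) else just (c , k)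

maxEmptyBelow : Diagram → ℕ → ℕ → Maybe ℕ
maxEmptyBelow D c zero    = nothing
maxEmptyBelow D c (suc k) =
  if isEmpty D (suc k) c then just (suc k) else maxEmptyBelow D c k

openRange : ℕ → ℕ → List ℕ
openRange a b = map (λ i → suc a + i) (upTo (b ∸ suc a))

relocate : ℕ → ℕ → ℕ → Diagram → Diagram
relocate r c r̂ D =
  cell r c ghost ∷ map (λ x → if samePos r c x then cell r̂ c (kind x) else x) D

ghostMove : ℕ → Diagram → Diagram
ghostMove r D with rightmost D r
... | nothing = D
... | just (c , ghost) = D
... | just (c , ord) with maxEmptyBelow D c (r ∸ 1)
...   | nothing = D
...   | just r̂ =
  if any (λ r* → isGhostAt D r* c) (openRange r̂ r) then D else relocate r c r̂ D

GhostStep : Diagram → Diagram → Set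
GhostStep D E = ∃ λ r → E ≡ ghostMove r D

GKD : Diagram → Diagram → Set
GKD = Star GhostStep

MaxGIs : Diagram → ℕ → Set
MaxGIs D n = (∃ λ E → GKD D E × ghosts E ≡ n) × (∀ E → GKD D E → ghosts E ≤ n)

memb : ℕ → List ℕ → Bool
memb n = any (λ m → m ≡ᵇ n)

maxL : List ℕ → Maybe ℕ
maxL []       = nothing
maxL (x ∷ xs) = just (maybe (λ m → x ⊔ m) x (maxL xs))

maxRow : Diagram → ℕ
maxRow D = foldr _⊔_ 0 (map row D)

maxCol : Diagram → ℕ
maxCol D = foldr _⊔_ 0 (map col D)

rowsOf : Diagram → ℕ → List ℕ
rowsOf D c = map row (filter (λ x → T? (col x ≡ᵇ c)) D)

rowsRight : Diagram → ℕ → List ℕ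
rowsRight D c = map row (filter (λ x → T? (c <ᵇ col x)) D)

-- Result: list of (row , label).  Rows in F = Rs ∩ U get their own row;
-- then rows of Rs ∖ U are processed in decreasing order.
-- (For the last column U = [] and every cell gets label 1.)
labelStep : List ℕ → List (ℕ × ℕ) → ℕ → List (ℕ × ℕ)
labelStep U acc r =
  (r , maybe (λ l → l) 1
         (maxL (filter (λ x → T? ((x <ᵇ r) ∧ not (memb x (map proj₂ acc)))) U)))
  ∷ acc

labelsCol : List ℕ → List ℕ → List (ℕ × ℕ)
labelsCol Rs U =
  foldl (labelStep U)
        (map (λ r → r , r) (filter (λ r → T? (memb r U)) Rs))
        (filter (λ r → T? (memb r Rs ∧ not (memb r U))) (downFrom (suc (foldr _⊔_ 0 Rs))))

lookupL : ℕ → List (ℕ × ℕ) → Maybe ℕ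
lookupL r []             = nothing
lookupL r ((r' , l) ∷ t) = if r' ≡ᵇ r then just l else lookupL r t

label : Diagram → ℕ → ℕ → Maybe ℕ
label D r c = lookupL r (labelsCol (rowsOf D c) (rowsRight D c))

isSnow : Diagram → ℕ → ℕ → Bool
isSnow D r c =
  (1 ≤ᵇ r) ∧ (1 ≤ᵇ c) ∧ isEmpty D r c ∧
  any (λ x → (col x ≡ᵇ c) ∧ (r <ᵇ row x) ∧ maybe (λ l → l ≤ᵇ r) false (label D (row x) c)) D

-- positions (r,c) with 1 ≤ r,c ≤ bounds (all snowflakes lie here)
positions : Diagram → List (ℕ × ℕ)
positions D = concatMap (λ r → map (λ c → r , c) (upTo (suc (maxCol D)))) (upTo (suc (maxRow D)))

sf : Diagram → ℕ
sf D = length (filter (λ p → T? (isSnow D (proj₁ p) (proj₂ p))) (positions D))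

{- Fix a column c.  Call an ordinary cell of c movable when it is the rightmost cell of its row, and an
   empty position (q , c) a hole when row q has a cell to the right of c.  A ghost move drops a movable
   cell to the highest empty position below it; landing in a hole it stops being movable, elsewhere it
   stays movable.  So the movable cells above an empty row e can all be caught strictly above e iff
   Hall's condition holds at e: each interval of rows (e , t] contains at most as many movable cells as
   (e , t) contains holes.  The labelling of the paper computes exactly the rows where it fails, i.e. the
   snowflakes.

   Upper bound: a ghost move never fills an empty row of D where Hall's condition holds, and it preserves
   the condition there; so every ghost occupies its own snowflake of D.
   Lower bound: repeatedly take the leftmost column with an unfilled snowflake e and drop its topmost
   movable cell.  As Hall's condition fails at e that cell lies above e, it lands on a snowflake at or
   above e, and Hall's condition keeps failing at the remaining unfilled snowflakes. -}

module Submission where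

open import Defs
open import Data.Bool using (Bool; true; false; _∧_; not; T; if_then_else_)
open import Data.Bool.ListAction using (any)
open import Data.Bool.Properties using (T-≡; not-¬; ∧-zeroʳ)
open import Data.Empty using (⊥; ⊥-elim)
open import Data.List
  using (List; []; _∷_; _++_; map; filter; foldr; foldl; downFrom; upTo; concatMap; cartesianProduct; length)
open import Data.List.Membership.Propositional using (_∈_; find; lose)
open import Data.List.Membership.Propositional.Properties
  using (∈-map⁺; ∈-map⁻; ∈-filter⁺; ∈-filter⁻; ∈-upTo⁺; ∈-upTo⁻; ∈-cartesianProduct⁺)
open import Data.List.Relation.Unary.All using (All; []; _∷_)
import Data.List.Relation.Unary.All as All
open import Data.List.Relation.Unary.Any using (here; there)
open import Data.List.Relation.Unary.Any.Properties using (any⁺; any⁻; ¬Any[])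
open import Data.List.Relation.Unary.Unique.Propositional using (Unique; _∷_)
open import Data.List.Relation.Unary.Unique.Propositional.Properties using (cartesianProduct⁺; upTo⁺)
open import Data.Maybe using (just; nothing; maybe)
open import Data.Maybe.Properties using (just-injective)
open import Data.Nat
open import Data.Nat.Properties
open import Algebra.Properties.CommutativeSemigroup +-commutativeSemigroup using (xy∙z≈xz∙y)
open import Data.Nat.Tactic.RingSolver using (solve-∀)
open import Data.Product using (_×_; _,_; proj₁; proj₂; ∃)
import Data.Sum
open import Data.Sum using (_⊎_; inj₁; inj₂)
open import Function using (_∘_; Equivalence)
open import Relation.Binary.Construct.Closure.ReflexiveTransitive using (ε; _◅_)
open import Relation.Binary.Definitions using (tri<; tri≈; tri>)
open import Relation.Binary.PropositionalEquality
open import Relation.Nullary using (¬_; yes; no)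
open import Relation.Nullary.Decidable using (T?)

≡true⇒T : ∀ {b} → b ≡ true → T b
≡true⇒T = Equivalence.from T-≡

T⇒≡true : ∀ {b} → T b → b ≡ true
T⇒≡true = Equivalence.to T-≡

false≢true : ∀ {b} → b ≡ false → b ≡ true → ⊥
false≢true = not-¬

∧-≡true⁻ : ∀ {a b} → (a ∧ b) ≡ true → a ≡ true × b ≡ true
∧-≡true⁻ {true} {true} _ = refl , refl

∧-≡true⁺ : ∀ {a b} → a ≡ true → b ≡ true → (a ∧ b) ≡ true
∧-≡true⁺ refl refl = refl

not-≡true⁻ : ∀ {a} → not a ≡ true → a ≡ false
not-≡true⁻ {false} _ = refl

not-≡true⁺ : ∀ {a} → a ≡ false → not a ≡ true
not-≡true⁺ refl = refl

bool-ext : ∀ {a b} → (a ≡ true → b ≡ true) → (b ≡ true → a ≡ true) → a ≡ b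
bool-ext {true}  {true}  _   _   = refl
bool-ext {true}  {false} a⇒b _   = sym (a⇒b refl)
bool-ext {false} {true}  _   b⇒a = b⇒a refl
bool-ext {false} {false} _   _   = refl

≡ᵇ⇒≡′ : ∀ {m n} → (m ≡ᵇ n) ≡ true → m ≡ n
≡ᵇ⇒≡′ {m} {n} e = ≡ᵇ⇒≡ m n (≡true⇒T e)

≡ᵇ-refl : ∀ n → (n ≡ᵇ n) ≡ true
≡ᵇ-refl n = T⇒≡true (≡⇒≡ᵇ n n refl)

≢⇒≡ᵇ≡false : ∀ {m n} → m ≢ n → (m ≡ᵇ n) ≡ false
≢⇒≡ᵇ≡false {m} {n} m≢n with m ≡ᵇ n in eq
... | false = refl
... | true  = ⊥-elim (m≢n (≡ᵇ⇒≡′ eq))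

<ᵇ⇒<′ : ∀ {m n} → (m <ᵇ n) ≡ true → m < n
<ᵇ⇒<′ {m} {n} e = <ᵇ⇒< m n (≡true⇒T e)

<⇒<ᵇ′ : ∀ {m n} → m < n → (m <ᵇ n) ≡ true
<⇒<ᵇ′ m<n = T⇒≡true (<⇒<ᵇ m<n)

<ᵇ≡false⇒≥ : ∀ {m n} → (m <ᵇ n) ≡ false → n ≤ m
<ᵇ≡false⇒≥ {m} {n} e with m <? n
... | yes m<n = ⊥-elim (false≢true e (<⇒<ᵇ′ m<n))
... | no m≮n  = ≮⇒≥ m≮n

≤ᵇ⇒≤′ : ∀ {m n} → (m ≤ᵇ n) ≡ true → m ≤ n
≤ᵇ⇒≤′ {m} {n} e = ≤ᵇ⇒≤ m n (≡true⇒T e)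

≤⇒≤ᵇ′ : ∀ {m n} → m ≤ n → (m ≤ᵇ n) ≡ true
≤⇒≤ᵇ′ m≤n = T⇒≡true (≤⇒≤ᵇ m≤n)

>⇒≤ᵇ≡false : ∀ {m n} → n < m → (m ≤ᵇ n) ≡ false
>⇒≤ᵇ≡false {m} {n} n<m with m ≤ᵇ n in eq
... | false = refl
... | true  = ⊥-elim (<⇒≱ n<m (≤ᵇ⇒≤′ eq))

module _ {A : Set} where

  ∈-filterᵇ⁺ : ∀ (f : A → Bool) {x xs} → x ∈ xs → f x ≡ true → x ∈ filter (T? ∘ f) xs
  ∈-filterᵇ⁺ f x∈xs fx = ∈-filter⁺ (T? ∘ f) x∈xs (≡true⇒T fx)

  ∈-filterᵇ⁻ : ∀ (f : A → Bool) {x} xs → x ∈ filter (T? ∘ f) xs → x ∈ xs × f x ≡ true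
  ∈-filterᵇ⁻ f xs x∈ with ∈-filter⁻ (T? ∘ f) {xs = xs} x∈
  ... | x∈xs , fx = x∈xs , T⇒≡true fx

  any-≡true⁺ : ∀ (f : A → Bool) {x xs} → x ∈ xs → f x ≡ true → any f xs ≡ true
  any-≡true⁺ f x∈xs fx = T⇒≡true (any⁺ f (lose x∈xs (≡true⇒T fx)))

  any-≡true⁻ : ∀ (f : A → Bool) xs → any f xs ≡ true → ∃ λ x → x ∈ xs × f x ≡ true
  any-≡true⁻ f xs e with find (any⁻ f xs (≡true⇒T e))
  ... | x , x∈xs , fx = x , x∈xs , T⇒≡true fx

  any-≡false⁺ : ∀ (f : A → Bool) xs → (∀ x → x ∈ xs → f x ≡ false) → any f xs ≡ false
  any-≡false⁺ f xs none with any f xs in eq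
  ... | false = refl
  ... | true  = let x , x∈xs , fx = any-≡true⁻ f xs eq in ⊥-elim (false≢true (none x x∈xs) fx)

memb⇒∈ : ∀ {n xs} → memb n xs ≡ true → n ∈ xs
memb⇒∈ {n} {xs} e with any-≡true⁻ (_≡ᵇ n) xs e
... | m , m∈xs , m≡n rewrite ≡ᵇ⇒≡′ {m} m≡n = m∈xs

∈⇒memb : ∀ {n xs} → n ∈ xs → memb n xs ≡ true
∈⇒memb {n} n∈xs = any-≡true⁺ (_≡ᵇ n) n∈xs (≡ᵇ-refl n)

memb≡false⇒∉ : ∀ {n xs} → memb n xs ≡ false → ¬ n ∈ xs
memb≡false⇒∉ absent n∈xs = false≢true absent (∈⇒memb n∈xs)

∉⇒memb≡false : ∀ {n xs} → ¬ n ∈ xs → memb n xs ≡ false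
∉⇒memb≡false {n} {xs} n∉xs with memb n xs in eq
... | false = refl
... | true  = ⊥-elim (n∉xs (memb⇒∈ eq))

IsMaximum : ℕ → List ℕ → Set
IsMaximum m xs = m ∈ xs × (∀ y → y ∈ xs → y ≤ m)

maxL-just : ∀ xs {m} → maxL xs ≡ just m → IsMaximum m xs
maxL-just (x ∷ [])     refl = here refl , λ { y (here refl) → ≤-refl }
maxL-just (x ∷ y ∷ ys) refl with maxL-just (y ∷ ys) refl
... | k∈ , k-max = x⊔k∈ , bound
  where
  k : ℕ
  k = maybe (y ⊔_) y (maxL ys)
  x⊔k∈ : x ⊔ k ∈ x ∷ y ∷ ys
  x⊔k∈ with ⊔-sel x k
  ... | inj₁ x⊔k≡x rewrite x⊔k≡x = here refl
  ... | inj₂ x⊔k≡k rewrite x⊔k≡k = there k∈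
  bound : ∀ z → z ∈ x ∷ y ∷ ys → z ≤ x ⊔ k
  bound z (here refl) = m≤m⊔n x k
  bound z (there z∈)  = ≤-trans (k-max z z∈) (m≤n⊔m x k)

maxL-nothing : ∀ xs → maxL xs ≡ nothing → xs ≡ []
maxL-nothing [] _ = refl

≤-foldr-⊔ : ∀ {x} xs → x ∈ xs → x ≤ foldr _⊔_ 0 xs
≤-foldr-⊔ (y ∷ xs) (here refl) = m≤m⊔n y _
≤-foldr-⊔ (y ∷ xs) (there x∈) = ≤-trans (≤-foldr-⊔ xs x∈) (m≤n⊔m y _)

ind : Bool → ℕ
ind true  = 1
ind false = 0

ind-mono : ∀ {b c} → (b ≡ true → c ≡ true) → ind b ≤ ind c
ind-mono {false} _ = z≤n
ind-mono {true} b⇒c rewrite b⇒c refl = ≤-refl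

count : (ℕ → Bool) → ℕ → ℕ → ℕ
count f a zero    = 0
count f a (suc b) = count f a b + ind ((a ≤ᵇ b) ∧ f b)

module _ (f : ℕ → Bool) where

  count-empty : ∀ a b → b ≤ a → count f a b ≡ 0
  count-empty a zero    _   = refl
  count-empty a (suc b) b<a
    rewrite count-empty a b (≤-trans (n≤1+n b) b<a) | >⇒≤ᵇ≡false {a} {b} b<a = refl

  count-snoc : ∀ a b → a ≤ b → count f a (suc b) ≡ count f a b + ind (f b)
  count-snoc a b a≤b rewrite ≤⇒≤ᵇ′ a≤b = refl

  count-split : ∀ a m b → a ≤ m → m ≤ b → count f a b ≡ count f a m + count f m b
  count-split a m b a≤m m≤b with m ≟ b
  ... | yes refl = sym (trans (cong (count f a m +_) (count-empty m m ≤-refl)) (+-identityʳ _))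
  count-split a m zero a≤m z≤n | no m≢0 = ⊥-elim (m≢0 refl)
  count-split a m (suc b) a≤m m≤b | no m≢b =
    begin
      count f a b + ind ((a ≤ᵇ b) ∧ f b)
    ≡⟨ cong₂ _+_ (count-split a m b a≤m m≤b′) (cong (λ x → ind (x ∧ f b)) a≤b≡m≤b) ⟩
      count f a m + count f m b + ind ((m ≤ᵇ b) ∧ f b)
    ≡⟨ +-assoc (count f a m) _ _ ⟩
      count f a m + count f m (suc b)
    ∎
    where
    open ≡-Reasoning
    m≤b′ : m ≤ b
    m≤b′ = ≤-pred (≤∧≢⇒< m≤b m≢b)
    a≤b≡m≤b : (a ≤ᵇ b) ≡ (m ≤ᵇ b)
    a≤b≡m≤b = trans (≤⇒≤ᵇ′ (≤-trans a≤m m≤b′)) (sym (≤⇒≤ᵇ′ m≤b′))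

  count-point : ∀ a p b → a ≤ p → p < b → count f a b ≡ count f a p + ind (f p) + count f (suc p) b
  count-point a p b a≤p p<b =
    begin
      count f a b
    ≡⟨ count-split a p b a≤p (<⇒≤ p<b) ⟩
      count f a p + count f p b
    ≡⟨ cong (count f a p +_) (count-split p (suc p) b (n≤1+n p) p<b) ⟩
      count f a p + (count f p (suc p) + count f (suc p) b)
    ≡⟨ cong (λ x → count f a p + (x + count f (suc p) b)) count-singleton ⟩
      count f a p + (ind (f p) + count f (suc p) b)
    ≡⟨ +-assoc (count f a p) _ _ ⟨
      count f a p + ind (f p) + count f (suc p) b
    ∎
    where
    open ≡-Reasoning
    count-singleton : count f p (suc p) ≡ ind (f p)
    count-singleton = trans (count-snoc p p ≤-refl) (cong (_+ ind (f p)) (count-empty p p ≤-refl))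

  count-head : ∀ a b → a < b → count f a b ≡ ind (f a) + count f (suc a) b
  count-head a b a<b = trans (count-point a a b ≤-refl a<b)
                             (cong (λ x → x + ind (f a) + count f (suc a) b) (count-empty a a ≤-refl))

  count-none : ∀ a b → (∀ r → a ≤ r → r < b → f r ≡ false) → count f a b ≡ 0
  count-none a zero    _    = refl
  count-none a (suc b) none with a ≤? b
  ... | yes a≤b rewrite count-snoc a b a≤b | none b a≤b ≤-refl
                      | count-none a b (λ r a≤r r<b → none r a≤r (m<n⇒m<1+n r<b)) = refl
  ... | no a≰b = count-empty a (suc b) (≰⇒> a≰b)

  count-pos : ∀ a p b → a ≤ p → p < b → f p ≡ true → 1 ≤ count f a b
  count-pos a p b a≤p p<b fp rewrite count-point a p b a≤p p<b | fp =
    ≤-trans (m≤n+m 1 (count f a p)) (m≤m+n _ _)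

  count-monoʳ : ∀ a b b′ → b ≤ b′ → count f a b ≤ count f a b′
  count-monoʳ a b b′ b≤b′ with a ≤? b
  ... | yes a≤b = ≤-trans (m≤m+n _ _) (≤-reflexive (sym (count-split a b b′ a≤b b≤b′)))
  ... | no a≰b rewrite count-empty a b (<⇒≤ (≰⇒> a≰b)) = z≤n

  count-monoˡ : ∀ a a′ b → a ≤ a′ → count f a′ b ≤ count f a b
  count-monoˡ a a′ b a≤a′ with a′ ≤? b
  ... | yes a′≤b = ≤-trans (m≤n+m _ _) (≤-reflexive (sym (count-split a a′ b a≤a′ a′≤b)))
  ... | no a′≰b rewrite count-empty a′ b (<⇒≤ (≰⇒> a′≰b)) = z≤n

count-mono : ∀ f g a b → (∀ r → a ≤ r → r < b → f r ≡ true → g r ≡ true) → count f a b ≤ count g a b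
count-mono f g a zero    _   = z≤n
count-mono f g a (suc b) f⇒g with a ≤? b | count-mono f g a b (λ r a≤r r<b → f⇒g r a≤r (m<n⇒m<1+n r<b))
... | no a≰b  | below rewrite >⇒≤ᵇ≡false (≰⇒> a≰b) = +-monoˡ-≤ 0 below
... | yes a≤b | below rewrite ≤⇒≤ᵇ′ a≤b = +-mono-≤ below (ind-mono (f⇒g b a≤b ≤-refl))

count-cong : ∀ f g a b → (∀ r → a ≤ r → r < b → f r ≡ g r) → count f a b ≡ count g a b
count-cong f g a b f≡g = ≤-antisym (count-mono f g a b (λ r a≤r r<b fr → trans (sym (f≡g r a≤r r<b)) fr))
                                   (count-mono g f a b (λ r a≤r r<b gr → trans (f≡g r a≤r r<b) gr))

count-update : ∀ f f′ a p b → a ≤ p → p < b → (∀ q → a ≤ q → q < b → q ≢ p → f′ q ≡ f q) →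
               count f′ a b + ind (f p) ≡ count f a b + ind (f′ p)
count-update f f′ a p b a≤p p<b same =
  begin
    count f′ a b + ind (f p)
  ≡⟨ cong (_+ ind (f p)) (count-point f′ a p b a≤p p<b) ⟩
    count f′ a p + ind (f′ p) + count f′ (suc p) b + ind (f p)
  ≡⟨ cong₂ (λ x y → x + ind (f′ p) + y + ind (f p)) below above ⟩
    count f a p + ind (f′ p) + count f (suc p) b + ind (f p)
  ≡⟨ swap-middle (count f a p) (ind (f′ p)) (count f (suc p) b) (ind (f p)) ⟩
    count f a p + ind (f p) + count f (suc p) b + ind (f′ p)
  ≡⟨ cong (_+ ind (f′ p)) (count-point f a p b a≤p p<b) ⟨
    count f a b + ind (f′ p)
  ∎
  where
  open ≡-Reasoning
  below : count f′ a p ≡ count f a p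
  below = count-cong f′ f a p (λ q a≤q q<p → same q a≤q (<-trans q<p p<b) (<⇒≢ q<p))
  above : count f′ (suc p) b ≡ count f (suc p) b
  above = count-cong f′ f (suc p) b (λ q p<q q<b → same q (≤-trans a≤p (<⇒≤ p<q)) q<b (≢-sym (<⇒≢ p<q)))
  swap-middle : ∀ w x y z → w + x + y + z ≡ w + z + y + x
  swap-middle = solve-∀

-- Hall's condition in one column

-- Hall's condition for matching the movable cells O above row e to distinct holes H strictly between e
-- and them.  For a column of D it fails at an empty row e exactly when (e , c) carries a snowflake.
Hall : (ℕ → Bool) → (ℕ → Bool) → ℕ → Set
Hall O H e = ∀ t → count O (suc e) (suc t) ≤ count H (suc e) t

Hall-mono : ∀ {O O′ H H′} e → (∀ q → O′ q ≡ true → O q ≡ true) →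
            (∀ q → H q ≡ true → H′ q ≡ true) → Hall O H e → Hall O′ H′ e
Hall-mono {O} {O′} {H} {H′} e O′⊆O H⊆H′ hall t =
  ≤-trans (count-mono O′ O (suc e) (suc t) (λ q _ _ → O′⊆O q))
    (≤-trans (hall t) (count-mono H H′ (suc e) t (λ q _ _ → H⊆H′ q)))

Hall-cong : ∀ {O O′ H H′} e → (∀ q → e < q → O q ≡ O′ q) → (∀ q → e < q → H q ≡ H′ q) →
            Hall O H e → Hall O′ H′ e
Hall-cong {O} {O′} {H} {H′} e O≡O′ H≡H′ hall t =
  subst₂ _≤_ (count-cong O O′ (suc e) (suc t) (λ q e<q _ → O≡O′ q e<q))
             (count-cong H H′ (suc e) t (λ q e<q _ → H≡H′ q e<q)) (hall t)

Hall-congᴼ : ∀ {O O′ H} e → (∀ q → O q ≡ O′ q) → Hall O H e → Hall O′ H e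
Hall-congᴼ e O≡O′ = Hall-cong e (λ q _ → O≡O′ q) (λ _ _ → refl)

Hall-vacuous : ∀ O H e → (∀ q → e < q → O q ≡ false) → Hall O H e
Hall-vacuous O H e none t rewrite count-none O (suc e) (suc t) (λ q e<q _ → none q e<q) = z≤n

unmatched⇒¬Hall : ∀ O H e r → O r ≡ true → e < r → (∀ q → e < q → q < r → H q ≡ false) → ¬ Hall O H e
unmatched⇒¬Hall O H e r Or e<r noHole hall = <⇒≱ (subst (_< count O (suc e) (suc r)) (sym noHoles) oneCell) (hall r)
  where
  noHoles : count H (suc e) r ≡ 0
  noHoles = count-none H (suc e) r noHole
  oneCell : 0 < count O (suc e) (suc r)
  oneCell = count-pos O (suc e) r (suc r) e<r ≤-refl Or

Hall-suc-noHole : ∀ O H e → H (suc e) ≡ false → Hall O H e → Hall O H (suc e)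
Hall-suc-noHole O H e no-hole hall t with suc e <? t
... | yes e+1<t = ≤-trans (count-monoˡ O (suc e) (suc (suc e)) (suc t) (n≤1+n _))
                    (≤-trans (hall t) (≤-reflexive (trans (count-head H (suc e) t e+1<t)
                                                          (cong (λ x → ind x + count H (suc (suc e)) t) no-hole))))
... | no e+1≮t rewrite count-empty O (suc (suc e)) (suc t) (s≤s (≮⇒≥ e+1≮t)) = z≤n

+ind-not≤⇒+1≤+ind : ∀ x y b → x + ind (not b) ≤ y → x + 1 ≤ y + ind b
+ind-not≤⇒+1≤+ind x y true  x+0≤y = +-monoˡ-≤ 1 (subst (_≤ y) (+-identityʳ x) x+0≤y)
+ind-not≤⇒+1≤+ind x y false x+1≤y = subst (x + 1 ≤_) (sym (+-identityʳ y)) x+1≤y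

+1≤+ind⇒+ind-not≤ : ∀ x y b → x + 1 ≤ y + ind b → x + ind (not b) ≤ y
+1≤+ind⇒+ind-not≤ x y true  x+1≤y+1 = subst (_≤ y) (sym (+-identityʳ x)) (+-cancelʳ-≤ 1 x y x+1≤y+1)
+1≤+ind⇒+ind-not≤ x y false x+1≤y+0 = subst (x + 1 ≤_) (+-identityʳ y) x+1≤y+0

ind-not+ind : ∀ b → ind (not b) + ind b ≡ 1
ind-not+ind true  = refl
ind-not+ind false = refl

-- The movable cell at row r of a column moves down to the empty row r̂; b records whether row r̂ is
-- blocked, i.e. whether r̂ was a hole, which decides whether the cell stays movable there.
record ColumnMove (O H O′ H′ : ℕ → Bool) (b : Bool) (r r̂ : ℕ) : Set where
  field
    O-r       : O r ≡ true
    r̂<r       : r̂ < r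
    H-r̂       : H r̂ ≡ b
    H-between : ∀ q → r̂ < q → q < r → H q ≡ false
    O-r̂       : O r̂ ≡ false
    O′-r      : O′ r ≡ false
    O′-r̂      : O′ r̂ ≡ not b
    O′-other  : ∀ q → q ≢ r → q ≢ r̂ → O′ q ≡ O q
    H′-r̂      : H′ r̂ ≡ false
    H′-other  : ∀ q → q ≢ r̂ → H′ q ≡ H q

module ColumnMoveHall {O H O′ H′ b r r̂} (M : ColumnMove O H O′ H′ b r r̂) where
  open ColumnMove M

  ¬Hall-r̂ : ¬ Hall O H r̂
  ¬Hall-r̂ = unmatched⇒¬Hall O H r̂ r O-r r̂<r H-between

  Hall-above : ∀ e → r < e → Hall O H e → Hall O′ H′ e
  Hall-above e r<e = Hall-cong e
    (λ q e<q → sym (O′-other q (>⇒≢ (<-trans r<e e<q)) (>⇒≢ (<-trans (<-trans r̂<r r<e) e<q))))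
    (λ q e<q → sym (H′-other q (>⇒≢ (<-trans (<-trans r̂<r r<e) e<q))))

  module Counts (e : ℕ) (e<r̂ : e < r̂) where

    O′≡O-below : ∀ t → t ≤ r̂ → count O′ (suc e) t ≡ count O (suc e) t
    O′≡O-below t t≤r̂ = count-cong O′ O (suc e) t
      (λ q _ q<t → O′-other q (<⇒≢ (<-trans (<-≤-trans q<t t≤r̂) r̂<r)) (<⇒≢ (<-≤-trans q<t t≤r̂)))

    H′≡H-below : ∀ t → t ≤ r̂ → count H′ (suc e) t ≡ count H (suc e) t
    H′≡H-below t t≤r̂ = count-cong H′ H (suc e) t (λ q _ q<t → H′-other q (<⇒≢ (<-≤-trans q<t t≤r̂)))

    O′-window : ∀ t → r̂ < t → t ≤ r → count O′ (suc e) t ≡ count O (suc e) t + ind (not b)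
    O′-window t r̂<t t≤r =
      trans (sym (+-identityʳ _))
        (subst₂ (λ x y → count O′ (suc e) t + ind x ≡ count O (suc e) t + ind y) O-r̂ O′-r̂
          (count-update O O′ (suc e) r̂ t e<r̂ r̂<t (λ q _ q<t → O′-other q (<⇒≢ (<-≤-trans q<t t≤r)))))

    O′-past : ∀ t → r < t → count O′ (suc e) t + 1 ≡ count O (suc e) t + ind (not b)
    O′-past t r<t =
      begin
        count O′ (suc e) t + 1
      ≡⟨ cong (_+ 1) (count-split O′ (suc e) r t e≤r (<⇒≤ r<t)) ⟩
        count O′ (suc e) r + count O′ r t + 1
      ≡⟨ +-assoc (count O′ (suc e) r) _ 1 ⟩
        count O′ (suc e) r + (count O′ r t + 1)
      ≡⟨ cong₂ _+_ (O′-window r r̂<r ≤-refl) upper ⟩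
        count O (suc e) r + ind (not b) + count O r t
      ≡⟨ xy∙z≈xz∙y (count O (suc e) r) (ind (not b)) (count O r t) ⟩
        count O (suc e) r + count O r t + ind (not b)
      ≡⟨ cong (_+ ind (not b)) (count-split O (suc e) r t e≤r (<⇒≤ r<t)) ⟨
        count O (suc e) t + ind (not b)
      ∎
      where
      open ≡-Reasoning
      e≤r : suc e ≤ r
      e≤r = <-trans e<r̂ r̂<r
      upper : count O′ r t + 1 ≡ count O r t
      upper = trans (subst₂ (λ x y → count O′ r t + ind x ≡ count O r t + ind y) O-r O′-r
                       (count-update O O′ r r t ≤-refl r<t
                         (λ q r≤q _ q≢r → O′-other q q≢r (λ q≡r̂ → <⇒≱ r̂<r (subst (r ≤_) q≡r̂ r≤q)))))
                    (+-identityʳ _)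

    H′-past : ∀ t → r̂ < t → count H′ (suc e) t + ind b ≡ count H (suc e) t
    H′-past t r̂<t =
      trans (subst₂ (λ x y → count H′ (suc e) t + ind x ≡ count H (suc e) t + ind y) H-r̂ H′-r̂
               (count-update H H′ (suc e) r̂ t e<r̂ r̂<t (λ q _ _ → H′-other q)))
            (+-identityʳ _)

    H′-window : ∀ t → r̂ ≤ t → t ≤ r → count H′ (suc e) t ≡ count H (suc e) r̂
    H′-window t r̂≤t t≤r =
      begin
        count H′ (suc e) t
      ≡⟨ count-split H′ (suc e) r̂ t e<r̂ r̂≤t ⟩
        count H′ (suc e) r̂ + count H′ r̂ t
      ≡⟨ cong₂ _+_ (H′≡H-below r̂ ≤-refl) (count-none H′ r̂ t no-hole) ⟩
        count H (suc e) r̂ + 0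
      ≡⟨ +-identityʳ _ ⟩
        count H (suc e) r̂
      ∎
      where
      open ≡-Reasoning
      no-hole : ∀ q → r̂ ≤ q → q < t → H′ q ≡ false
      no-hole q r̂≤q q<t with q ≟ r̂
      ... | yes refl = H′-r̂
      ... | no q≢r̂ = trans (H′-other q q≢r̂) (H-between q (≤∧≢⇒< r̂≤q (≢-sym q≢r̂)) (<-≤-trans q<t t≤r))

    H-upto-r : count H (suc e) r ≡ count H (suc e) r̂ + ind b
    H-upto-r = trans (sym (H′-past r r̂<r)) (cong (_+ ind b) (H′-window r (<⇒≤ r̂<r) ≤-refl))

    O-upto-r : count O (suc e) (suc r) ≡ count O (suc e) r + 1
    O-upto-r = trans (count-snoc O (suc e) r (<-trans e<r̂ r̂<r)) (cong (λ x → count O (suc e) r + ind x) O-r)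

    Hall′-window : Hall O H e → ∀ t → r̂ ≤ t → t < r → count O′ (suc e) (suc t) ≤ count H′ (suc e) t
    Hall′-window hall t r̂≤t t<r =
      subst₂ _≤_ (sym (O′-window (suc t) (s≤s r̂≤t) t<r)) (sym (H′-window t r̂≤t (<⇒≤ t<r)))
        (+1≤+ind⇒+ind-not≤ (count O (suc e) (suc t)) (count H (suc e) r̂) b
          (≤-trans (+-monoˡ-≤ 1 (count-monoʳ O (suc e) (suc t) r t<r))
            (subst₂ _≤_ O-upto-r H-upto-r (hall r))))

    Hall′-past : Hall O H e → ∀ t → r ≤ t → count O′ (suc e) (suc t) ≤ count H′ (suc e) t
    Hall′-past hall t r≤t = +-cancelʳ-≤ 1 _ _
      (begin
        count O′ (suc e) (suc t) + 1
      ≡⟨ O′-past (suc t) (s≤s r≤t) ⟩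
        count O (suc e) (suc t) + ind (not b)
      ≤⟨ +-monoˡ-≤ (ind (not b)) (hall t) ⟩
        count H (suc e) t + ind (not b)
      ≡⟨ cong (_+ ind (not b)) (H′-past t (<-≤-trans r̂<r r≤t)) ⟨
        count H′ (suc e) t + ind b + ind (not b)
      ≡⟨ trans (+-assoc (count H′ (suc e) t) _ _)
               (cong (count H′ (suc e) t +_) (trans (+-comm (ind b) _) (ind-not+ind b))) ⟩
        count H′ (suc e) t + 1
      ∎)
      where open ≤-Reasoning

    Hall-past : (∀ q → r < q → O q ≡ false) → Hall O′ H′ e →
                ∀ t → r ≤ t → count O (suc e) (suc t) ≤ count H (suc e) t
    Hall-past top hall′ t r≤t =
      begin
        count O (suc e) (suc t)
      ≡⟨ count-split O (suc e) (suc r) (suc t) (m<n⇒m<1+n e<r) (s≤s r≤t) ⟩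
        count O (suc e) (suc r) + count O (suc r) (suc t)
      ≡⟨ cong (count O (suc e) (suc r) +_) (count-none O (suc r) (suc t) (λ q r<q _ → top q r<q)) ⟩
        count O (suc e) (suc r) + 0
      ≡⟨ trans (+-identityʳ _) O-upto-r ⟩
        count O (suc e) r + 1
      ≤⟨ +ind-not≤⇒+1≤+ind _ _ b hall′-below-r ⟩
        count H (suc e) r̂ + ind b
      ≡⟨ H-upto-r ⟨
        count H (suc e) r
      ≤⟨ count-monoʳ H (suc e) r t r≤t ⟩
        count H (suc e) t
      ∎
      where
      open ≤-Reasoning
      e<r : e < r
      e<r = <-trans e<r̂ r̂<r
      instance
        r≢0 : NonZero r
        r≢0 = >-nonZero (≤-<-trans z≤n e<r)
      hall′-below-r : count O (suc e) r + ind (not b) ≤ count H (suc e) r̂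
      hall′-below-r = subst₂ _≤_ (trans (cong (count O′ (suc e)) (suc-pred r)) (O′-window r r̂<r ≤-refl))
                                 (H′-window (pred r) (<⇒≤pred r̂<r) pred[n]≤n)
                                 (hall′ (pred r))

  O⊆O′-below-r : ∀ q → q < r → O q ≡ true → O′ q ≡ true
  O⊆O′-below-r q q<r Oq with q ≟ r̂
  ... | yes refl = ⊥-elim (false≢true O-r̂ Oq)
  ... | no q≢r̂   = trans (O′-other q (<⇒≢ q<r) q≢r̂) Oq

  H′⊆H : ∀ q → H′ q ≡ true → H q ≡ true
  H′⊆H q H′q with q ≟ r̂
  ... | yes refl = ⊥-elim (false≢true H′-r̂ H′q)
  ... | no q≢r̂   = trans (sym (H′-other q q≢r̂)) H′q

  Hall-below : ∀ e → e < r̂ → Hall O H e → Hall O′ H′ e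
  Hall-below e e<r̂ hall t with suc t ≤? r̂ | suc t ≤? r
  ... | yes t<r̂ | _       = subst₂ _≤_ (sym (O′≡O-below (suc t) t<r̂)) (sym (H′≡H-below t (<⇒≤ t<r̂))) (hall t)
    where open Counts e e<r̂
  ... | no t≮r̂  | yes t<r = Counts.Hall′-window e e<r̂ hall t (≮⇒≥ t≮r̂) t<r
  ... | no _    | no t≮r  = Counts.Hall′-past e e<r̂ hall t (≮⇒≥ t≮r)

  Hall-below⁻ : (∀ q → r < q → O q ≡ false) → ∀ e → e < r̂ → Hall O′ H′ e → Hall O H e
  Hall-below⁻ top e e<r̂ hall′ t with suc t ≤? r
  ... | yes t<r = ≤-trans (count-mono O O′ (suc e) (suc t) (λ q _ q≤t → O⊆O′-below-r q (<-≤-trans q≤t t<r)))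
                    (≤-trans (hall′ t) (count-mono H′ H (suc e) t (λ q _ _ → H′⊆H q)))
  ... | no t≮r  = Counts.Hall-past e e<r̂ top hall′ t (≮⇒≥ t≮r)

-- The labelling computes Hall's condition

-- R and U are the paper's R_i and the union of the R_j with j > i, for the column being labelled.
module Labelling (R U : List ℕ) (0∉R : memb 0 R ≡ false) where

  inR inU : ℕ → Bool
  inR q = memb q R
  inU q = memb q U

  O H : ℕ → Bool
  O q = inR q ∧ not (inU q)
  H q = not (inR q) ∧ inU q

  O≥ : ℕ → ℕ → Bool
  O≥ n q = O q ∧ (n ≤ᵇ q)

  O≥-below : ∀ n q → q < n → O≥ n q ≡ false
  O≥-below n q q<n rewrite >⇒≤ᵇ≡false {n} {q} q<n with O q
  ... | true  = refl
  ... | false = refl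

  O≥-self : ∀ s → O≥ s s ≡ O s
  O≥-self s rewrite ≤⇒≤ᵇ′ (≤-refl {s}) with O s
  ... | true  = refl
  ... | false = refl

  O≥-zero : ∀ q → O≥ 0 q ≡ O q
  O≥-zero q with O q
  ... | true  = refl
  ... | false = refl

  O≥-suc : ∀ s q → q ≢ s → O≥ (suc s) q ≡ O≥ s q
  O≥-suc s q q≢s with s <? q
  ... | yes s<q rewrite ≤⇒≤ᵇ′ s<q | ≤⇒≤ᵇ′ (<⇒≤ s<q) = refl
  ... | no s≮q = trans (O≥-below (suc s) q (m<n⇒m<1+n q<s)) (sym (O≥-below s q q<s))
    where
    q<s : q < s
    q<s = ≤∧≢⇒< (≮⇒≥ s≮q) q≢s

  O≥-suc-⊆ : ∀ s q → O≥ (suc s) q ≡ true → O≥ s q ≡ true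
  O≥-suc-⊆ s q O≥q with q ≟ s
  ... | yes refl = ⊥-elim (false≢true (O≥-below (suc s) s ≤-refl) O≥q)
  ... | no q≢s = trans (sym (O≥-suc s q q≢s)) O≥q

  count-O≥-suc : ∀ s a b → O s ≡ true → a ≤ s → s < b → count (O≥ (suc s)) a b + 1 ≡ count (O≥ s) a b
  count-O≥-suc s a b Os a≤s s<b =
    trans (subst₂ (λ x y → count (O≥ (suc s)) a b + ind x ≡ count (O≥ s) a b + ind y)
                  (trans (O≥-self s) Os) (O≥-below (suc s) s ≤-refl)
                  (count-update (O≥ s) (O≥ (suc s)) a s b a≤s s<b (λ q _ _ → O≥-suc s q)))
          (+-identityʳ _)

  Hall-suc-hole : ∀ s e → O s ≡ true → suc e < s → H (suc e) ≡ true →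
                  Hall (O≥ s) H e → Hall (O≥ (suc s)) H (suc e)
  Hall-suc-hole s e Os e+1<s hole hall t with t <? s
  ... | yes t<s
    rewrite count-none (O≥ (suc s)) (suc (suc e)) (suc t)
                       (λ q _ q≤t → O≥-below (suc s) q (≤-trans q≤t (<⇒≤ (s≤s t<s))))
    = z≤n
  ... | no t≮s = +-cancelʳ-≤ 1 _ _
    (begin
      count (O≥ (suc s)) (suc (suc e)) (suc t) + 1
    ≡⟨ count-O≥-suc s (suc (suc e)) (suc t) Os e+1<s (s≤s s≤t) ⟩
      count (O≥ s) (suc (suc e)) (suc t)
    ≤⟨ count-monoˡ (O≥ s) (suc e) (suc (suc e)) (suc t) (n≤1+n _) ⟩
      count (O≥ s) (suc e) (suc t)
    ≤⟨ hall t ⟩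
      count H (suc e) t
    ≡⟨ count-head H (suc e) t (<-≤-trans e+1<s s≤t) ⟩
      ind (H (suc e)) + count H (suc (suc e)) t
    ≡⟨ trans (cong (λ x → ind x + count H (suc (suc e)) t) hole) (+-comm 1 _) ⟩
      count H (suc (suc e)) t + 1
    ∎)
    where
    open ≤-Reasoning
    s≤t : s ≤ t
    s≤t = ≮⇒≥ t≮s

  Hall-merge : ∀ s e m → O s ≡ true → e < m → m < s → H m ≡ true →
               Hall (O≥ (suc s)) H e → Hall (O≥ (suc s)) H m → Hall (O≥ s) H e
  Hall-merge s e m Os e<m m<s hole hall-e hall-m t with t <? s
  ... | yes t<s = subst (_≤ count H (suc e) t)
                    (count-cong (O≥ (suc s)) (O≥ s) (suc e) (suc t)
                                (λ q _ q≤t → O≥-suc s q (<⇒≢ (<-≤-trans q≤t t<s))))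
                    (hall-e t)
  ... | no t≮s =
    begin
      count (O≥ s) (suc e) (suc t)
    ≡⟨ count-split (O≥ s) (suc e) (suc m) (suc t) (s≤s (<⇒≤ e<m)) (s≤s (<⇒≤ (<-≤-trans m<s s≤t))) ⟩
      count (O≥ s) (suc e) (suc m) + count (O≥ s) (suc m) (suc t)
    ≡⟨ cong (_+ count (O≥ s) (suc m) (suc t))
            (count-none (O≥ s) (suc e) (suc m) (λ q _ q≤m → O≥-below s q (<-≤-trans q≤m m<s))) ⟩
      count (O≥ s) (suc m) (suc t)
    ≡⟨ count-O≥-suc s (suc m) (suc t) Os m<s (s≤s s≤t) ⟨
      count (O≥ (suc s)) (suc m) (suc t) + 1
    ≤⟨ +-monoˡ-≤ 1 (hall-m t) ⟩
      count H (suc m) t + 1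
    ≤⟨ m≤n+m _ (count H (suc e) m) ⟩
      count H (suc e) m + (count H (suc m) t + 1)
    ≡⟨ trans (cong (count H (suc e) m +_) (+-comm _ 1)) (sym (+-assoc (count H (suc e) m) 1 _)) ⟩
      count H (suc e) m + 1 + count H (suc m) t
    ≡⟨ cong (λ x → count H (suc e) m + ind x + count H (suc m) t) hole ⟨
      count H (suc e) m + ind (H m) + count H (suc m) t
    ≡⟨ count-point H (suc e) m t e<m (<-≤-trans m<s s≤t) ⟨
      count H (suc e) t
    ∎
    where
    open ≤-Reasoning
    s≤t : s ≤ t
    s≤t = ≮⇒≥ t≮s

  Labels : Set
  Labels = List (ℕ × ℕ)

  Used : Labels → ℕ → Set
  Used acc u = u ∈ map proj₂ acc

  Snow : Labels → ℕ → Set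
  Snow acc e = ∃ λ k → ∃ λ l → (k , l) ∈ acc × e < k × l ≤ e

  Free : Labels → ℕ → ℕ → Bool
  Free acc s x = (x <ᵇ s) ∧ not (memb x (map proj₂ acc))

  nextLabel : Labels → ℕ → ℕ
  nextLabel acc s = maybe (λ l → l) 1 (maxL (filter (T? ∘ Free acc s) U))

  Free-intro : ∀ acc s u → u < s → ¬ Used acc u → Free acc s u ≡ true
  Free-intro acc s u u<s unused = ∧-≡true⁺ (<⇒<ᵇ′ u<s) (not-≡true⁺ (∉⇒memb≡false unused))

  data NextLabel (acc : Labels) (s : ℕ) : Set where
    largest-free : ∀ m → nextLabel acc s ≡ m → inU m ≡ true → m < s → ¬ Used acc m →
                   (∀ u → inU u ≡ true → u < s → ¬ Used acc u → u ≤ m) → NextLabel acc s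
    none-free    : nextLabel acc s ≡ 1 → (∀ u → inU u ≡ true → u < s → Used acc u) → NextLabel acc s

  nextLabel-cases : ∀ acc s → NextLabel acc s
  nextLabel-cases acc s with maxL (filter (T? ∘ Free acc s) U) in eq
  ... | just m = largest-free m (cong (maybe (λ l → l) 1) eq) (∈⇒memb m∈U) (<ᵇ⇒<′ (proj₁ m-free))
                   (λ m-used → false≢true (not-≡true⁻ (proj₂ m-free)) (∈⇒memb m-used))
                   (λ u inU-u u<s unused →
                      proj₂ m-max u (∈-filterᵇ⁺ (Free acc s) (memb⇒∈ {xs = U} inU-u) (Free-intro acc s u u<s unused)))
    where
    m-max = maxL-just _ eq
    m∈U = proj₁ (∈-filterᵇ⁻ (Free acc s) U (proj₁ m-max))
    m-free = ∧-≡true⁻ (proj₂ (∈-filterᵇ⁻ (Free acc s) U (proj₁ m-max)))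
  ... | nothing = none-free (cong (maybe (λ l → l) 1) eq) all-used
    where
    all-used : ∀ u → inU u ≡ true → u < s → Used acc u
    all-used u inU-u u<s with memb u (map proj₂ acc) in used
    ... | true  = memb⇒∈ used
    ... | false = ⊥-elim (¬Any[] (subst (u ∈_) (maxL-nothing _ eq)
                    (∈-filterᵇ⁺ (Free acc s) (memb⇒∈ {xs = U} inU-u) (Free-intro acc s u u<s (memb≡false⇒∉ used)))))

  -- The fold labels the movable rows downwards.  Once all rows ≥ n are labelled, Snow decides Hall's
  -- condition for the movable cells in rows ≥ n; the other fields make the next label the right one.
  record Invariant (n : ℕ) (acc : Labels) : Set where
    field
      snow⇒¬Hall    : ∀ e → 1 ≤ e → Snow acc e → ¬ Hall (O≥ n) H e
      ¬snow⇒Hall    : ∀ e → 1 ≤ e → ¬ Snow acc e → Hall (O≥ n) H e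
      snowy-used    : ∀ u → inU u ≡ true → Snow acc u → Used acc u
      labelled-inR  : ∀ k l → (k , l) ∈ acc → inR k ≡ true × l ≤ k
      labelled-from : ∀ k l → (k , l) ∈ acc → (inU k ≡ true × l ≡ k) ⊎ (inU k ≡ false × n ≤ k)
      label-unique  : ∀ k l l′ → (k , l) ∈ acc → (k , l′) ∈ acc → l ≡ l′
      shared-used   : ∀ m → inR m ≡ true → inU m ≡ true → Used acc m

  Snow-∷⁻ : ∀ {acc k l e} → Snow ((k , l) ∷ acc) e → Snow acc e ⊎ (e < k × l ≤ e)
  Snow-∷⁻ (k , l , here refl , e<k , l≤e) = inj₂ (e<k , l≤e)
  Snow-∷⁻ (k , l , there kl∈ , e<k , l≤e) = inj₁ (k , l , kl∈ , e<k , l≤e)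

  Snow-∷⁺ : ∀ {acc x e} → Snow acc e → Snow (x ∷ acc) e
  Snow-∷⁺ (k , l , kl∈ , e<k , l≤e) = k , l , there kl∈ , e<k , l≤e

  inR-pos : ∀ n → inR n ≡ true → 1 ≤ n
  inR-pos zero    0∈R = ⊥-elim (false≢true 0∉R 0∈R)
  inR-pos (suc _) _   = s≤s z≤n

  module Step (s : ℕ) (acc : Labels) (Os : O s ≡ true) (I : Invariant (suc s) acc) where
    open Invariant I

    ℓ : ℕ
    ℓ = nextLabel acc s

    acc′ : Labels
    acc′ = (s , ℓ) ∷ acc

    inR-s : inR s ≡ true
    inR-s = proj₁ (∧-≡true⁻ Os)

    inU-s : inU s ≡ false
    inU-s = not-≡true⁻ (proj₂ (∧-≡true⁻ Os))

    gaps-used : ∀ e → ℓ ≤ e → ∀ u → e < u → u < s → inU u ≡ true → Used acc u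
    gaps-used e ℓ≤e u e<u u<s inU-u with nextLabel-cases acc s
    ... | none-free _ all-used = all-used u inU-u u<s
    ... | largest-free m ℓ≡m _ _ _ largest with memb u (map proj₂ acc) in used
    ...   | true  = memb⇒∈ used
    ...   | false = ⊥-elim (<⇒≱ e<u (≤-trans (largest u inU-u u<s (memb≡false⇒∉ used))
                                             (subst (_≤ e) ℓ≡m ℓ≤e)))

    -- Induction on the gap d = s - e - 1: each hole in the gap is an already used label, so Hall's
    -- condition fails just below it and the hole cannot absorb the cell s.
    ¬Hall-gaps-used : ∀ d e → suc d + e ≡ s → 1 ≤ e → (∀ u → e < u → u < s → inU u ≡ true → Used acc u) →
                      ¬ Hall (O≥ s) H e
    ¬Hall-gaps-used zero e refl _ _ =
      unmatched⇒¬Hall (O≥ s) H e s (trans (O≥-self s) Os) ≤-refl (λ q e<q q<s → ⊥-elim (<⇒≱ e<q (≤-pred q<s)))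
    ¬Hall-gaps-used (suc d) e d+e+2≡s 1≤e used with H (suc e) in hole
    ... | false = λ hall → ¬Hall-gaps-used d (suc e) (trans (cong suc (+-suc d e)) d+e+2≡s) (s≤s z≤n)
                             (λ u e+1<u → used u (<-trans (n<1+n e) e+1<u)) (Hall-suc-noHole (O≥ s) H e hole hall)
    ... | true  = λ hall → snow⇒¬Hall (suc e) (s≤s z≤n) snowy (Hall-suc-hole s e Os e+1<s hole hall)
      where
      e+1<s : suc e < s
      e+1<s = subst (suc e <_) d+e+2≡s (s≤s (s≤s (m≤n+m e d)))
      not-inR : inR (suc e) ≡ false
      not-inR = not-≡true⁻ (proj₁ (∧-≡true⁻ hole))
      snowy : Snow acc (suc e)
      snowy with ∈-map⁻ proj₂ (used (suc e) ≤-refl e+1<s (proj₂ (∧-≡true⁻ hole)))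
      ... | (k , l) , kl∈ , refl = k , l , kl∈ , l<k , ≤-refl
        where
        l<k : l < k
        l<k = ≤∧≢⇒< (proj₂ (labelled-inR k l kl∈))
                    (λ l≡k → false≢true not-inR
                               (subst (λ x → inR x ≡ true) (sym l≡k) (proj₁ (labelled-inR k l kl∈))))

    snow⇒¬Hall′ : ∀ e → 1 ≤ e → Snow acc′ e → ¬ Hall (O≥ s) H e
    snow⇒¬Hall′ e 1≤e snowy with Snow-∷⁻ snowy
    ... | inj₁ snowy-before = λ hall → snow⇒¬Hall e 1≤e snowy-before (Hall-mono e (O≥-suc-⊆ s) (λ _ Hq → Hq) hall)
    ... | inj₂ (e<s , ℓ≤e) = ¬Hall-gaps-used (s ∸ suc e) e gap 1≤e (gaps-used e ℓ≤e)
      where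
      gap : suc (s ∸ suc e) + e ≡ s
      gap = trans (sym (+-suc (s ∸ suc e) e)) (m∸n+n≡m e<s)

    ¬snow⇒Hall′ : ∀ e → 1 ≤ e → ¬ Snow acc′ e → Hall (O≥ s) H e
    ¬snow⇒Hall′ e 1≤e ¬snowy with e <? s
    ... | no e≮s = Hall-cong e (λ q e<q → O≥-suc s q (>⇒≢ (≤-<-trans (≮⇒≥ e≮s) e<q))) (λ _ _ → refl)
                     (¬snow⇒Hall e 1≤e (¬snowy ∘ Snow-∷⁺))
    ... | yes e<s with nextLabel-cases acc s
    ...   | none-free ℓ≡1 _ = ⊥-elim (¬snowy (s , ℓ , here refl , e<s , subst (_≤ e) (sym ℓ≡1) 1≤e))
    ...   | largest-free m ℓ≡m inU-m m<s m-unused _ with m ≤? e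
    ...     | yes m≤e = ⊥-elim (¬snowy (s , ℓ , here refl , e<s , subst (_≤ e) (sym ℓ≡m) m≤e))
    ...     | no m≰e = Hall-merge s e m Os (≰⇒> m≰e) m<s hole-m
                         (¬snow⇒Hall e 1≤e (¬snowy ∘ Snow-∷⁺))
                         (¬snow⇒Hall m (≤-trans 1≤e (<⇒≤ (≰⇒> m≰e))) (m-unused ∘ snowy-used m inU-m))
      where
      hole-m : H m ≡ true
      hole-m with inR m in inR-m
      ... | true  = ⊥-elim (m-unused (shared-used m inR-m inU-m))
      ... | false = inU-m

    snowy-used′ : ∀ u → inU u ≡ true → Snow acc′ u → Used acc′ u
    snowy-used′ u inU-u snowy with Snow-∷⁻ snowy
    ... | inj₁ snowy-before = there (snowy-used u inU-u snowy-before)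
    ... | inj₂ (u<s , ℓ≤u) with memb u (map proj₂ acc) in used
    ...   | true  = there (memb⇒∈ used)
    ...   | false with nextLabel-cases acc s
    ...     | none-free _ all-used = there (all-used u inU-u u<s)
    ...     | largest-free m ℓ≡m _ _ _ largest =
      here (≤-antisym (subst (u ≤_) (sym ℓ≡m) (largest u inU-u u<s (memb≡false⇒∉ used))) ℓ≤u)

    labelled-inR′ : ∀ k l → (k , l) ∈ acc′ → inR k ≡ true × l ≤ k
    labelled-inR′ k l (here refl) = inR-s , ℓ≤s
      where
      ℓ≤s : ℓ ≤ s
      ℓ≤s with nextLabel-cases acc s
      ... | largest-free m ℓ≡m _ m<s _ _ = subst (_≤ s) (sym ℓ≡m) (<⇒≤ m<s)
      ... | none-free ℓ≡1 _ = subst (_≤ s) (sym ℓ≡1) (inR-pos s inR-s)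
    labelled-inR′ k l (there kl∈) = labelled-inR k l kl∈

    labelled-from′ : ∀ k l → (k , l) ∈ acc′ → (inU k ≡ true × l ≡ k) ⊎ (inU k ≡ false × s ≤ k)
    labelled-from′ k l (here refl) = inj₂ (inU-s , ≤-refl)
    labelled-from′ k l (there kl∈) with labelled-from k l kl∈
    ... | inj₁ shared = inj₁ shared
    ... | inj₂ (inU-k , s<k) = inj₂ (inU-k , <⇒≤ s<k)

    s-fresh : ∀ l → (s , l) ∈ acc → ⊥
    s-fresh l sl∈ with labelled-from s l sl∈
    ... | inj₁ (inU-s′ , _) = false≢true inU-s inU-s′
    ... | inj₂ (_ , s+1≤s) = <-irrefl refl s+1≤s

    label-unique′ : ∀ k l l′ → (k , l) ∈ acc′ → (k , l′) ∈ acc′ → l ≡ l′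
    label-unique′ k l l′ (here refl)  (here refl)   = refl
    label-unique′ k l l′ (here refl)  (there kl′∈)  = ⊥-elim (s-fresh l′ kl′∈)
    label-unique′ k l l′ (there kl∈)  (here refl)   = ⊥-elim (s-fresh l kl∈)
    label-unique′ k l l′ (there kl∈)  (there kl′∈)  = label-unique k l l′ kl∈ kl′∈

    invariant : Invariant s acc′
    invariant = record
      { snow⇒¬Hall    = snow⇒¬Hall′
      ; ¬snow⇒Hall    = ¬snow⇒Hall′
      ; snowy-used    = snowy-used′
      ; labelled-inR  = labelled-inR′
      ; labelled-from = labelled-from′
      ; label-unique  = label-unique′
      ; shared-used   = λ m inR-m inU-m → there (shared-used m inR-m inU-m)
      }

  invariant-skip : ∀ s acc → O s ≡ false → Invariant (suc s) acc → Invariant s acc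
  invariant-skip s acc not-O I = record
    { snow⇒¬Hall    = λ e 1≤e snowy hall → snow⇒¬Hall e 1≤e snowy (Hall-congᴼ e (λ q → sym (O≥-suc′ q)) hall)
    ; ¬snow⇒Hall    = λ e 1≤e ¬snowy → Hall-congᴼ e O≥-suc′ (¬snow⇒Hall e 1≤e ¬snowy)
    ; snowy-used    = snowy-used
    ; labelled-inR  = labelled-inR
    ; labelled-from = λ k l kl∈ → Data.Sum.map₂ (λ (inU-k , s<k) → inU-k , <⇒≤ s<k) (labelled-from k l kl∈)
    ; label-unique  = label-unique
    ; shared-used   = shared-used
    }
    where
    open Invariant I
    O≥-suc′ : ∀ q → O≥ (suc s) q ≡ O≥ s q
    O≥-suc′ q with q ≟ s
    ... | yes refl = trans (O≥-below (suc s) s ≤-refl) (sym (trans (O≥-self s) not-O))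
    ... | no q≢s = O≥-suc s q q≢s

  invariant-fold : ∀ n acc → Invariant n acc → Invariant 0 (foldl (labelStep U) acc (filter (T? ∘ O) (downFrom n)))
  invariant-fold zero    acc I = I
  invariant-fold (suc n) acc I with O n in O-n
  ... | true  = invariant-fold n ((n , nextLabel acc n) ∷ acc) (Step.invariant n acc O-n I)
  ... | false = invariant-fold n acc (invariant-skip n acc O-n I)

  initial : Labels
  initial = map (λ r → r , r) (filter (T? ∘ inU) R)

  ∈-initial : ∀ {k l} → (k , l) ∈ initial → l ≡ k × inR k ≡ true × inU k ≡ true
  ∈-initial kl∈ with ∈-map⁻ (λ r → r , r) kl∈
  ... | r , r∈ , refl = refl , ∈⇒memb (proj₁ r∈R) , proj₂ r∈R
    where
    r∈R = ∈-filterᵇ⁻ inU R r∈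

  ¬Snow-initial : ∀ e → ¬ Snow initial e
  ¬Snow-initial e (k , l , kl∈ , e<k , l≤e) = <⇒≱ e<k (subst (_≤ e) (proj₁ (∈-initial kl∈)) l≤e)

  invariant-initial : Invariant (suc (foldr _⊔_ 0 R)) initial
  invariant-initial = record
    { snow⇒¬Hall    = λ e _ snowy → ⊥-elim (¬Snow-initial e snowy)
    ; ¬snow⇒Hall    = λ e _ _ → Hall-vacuous (O≥ (suc (foldr _⊔_ 0 R))) H e (λ q _ → nothing-above q)
    ; snowy-used    = λ u _ snowy → ⊥-elim (¬Snow-initial u snowy)
    ; labelled-inR  = λ k l kl∈ → let l≡k , inR-k , _ = ∈-initial kl∈ in inR-k , ≤-reflexive l≡k
    ; labelled-from = λ k l kl∈ → let l≡k , _ , inU-k = ∈-initial kl∈ in inj₁ (inU-k , l≡k)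
    ; label-unique  = λ k l l′ kl∈ kl′∈ → trans (proj₁ (∈-initial kl∈)) (sym (proj₁ (∈-initial kl′∈)))
    ; shared-used   = λ m inR-m inU-m →
        ∈-map⁺ proj₂ (∈-map⁺ (λ r → r , r) (∈-filterᵇ⁺ inU (memb⇒∈ {xs = R} inR-m) inU-m))
    }
    where
    nothing-above : ∀ q → O≥ (suc (foldr _⊔_ 0 R)) q ≡ false
    nothing-above q with q <? suc (foldr _⊔_ 0 R)
    ... | yes q≤max = O≥-below _ q q≤max
    ... | no q≰max with inR q in inR-q
    ...   | true  = ⊥-elim (q≰max (s≤s (≤-foldr-⊔ R (memb⇒∈ inR-q))))
    ...   | false = refl

  invariant-labels : Invariant 0 (labelsCol R U)
  invariant-labels = invariant-fold (suc (foldr _⊔_ 0 R)) initial invariant-initial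

  labels-snow⇒¬Hall : ∀ e → 1 ≤ e → Snow (labelsCol R U) e → ¬ Hall O H e
  labels-snow⇒¬Hall e 1≤e snowy hall =
    Invariant.snow⇒¬Hall invariant-labels e 1≤e snowy (Hall-congᴼ e (λ q → sym (O≥-zero q)) hall)

  labels-¬snow⇒Hall : ∀ e → 1 ≤ e → ¬ Snow (labelsCol R U) e → Hall O H e
  labels-¬snow⇒Hall e 1≤e ¬snowy = Hall-congᴼ e O≥-zero (Invariant.¬snow⇒Hall invariant-labels e 1≤e ¬snowy)

-- Positions, blocked rows and ghost moves

samePos-≡ : ∀ {r c x} → samePos r c x ≡ true → row x ≡ r × col x ≡ c
samePos-≡ {r} {c} {x} same = let row≡ , col≡ = ∧-≡true⁻ {row x ≡ᵇ r} same in
                             ≡ᵇ⇒≡′ row≡ , ≡ᵇ⇒≡′ col≡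

samePos-refl : ∀ x → samePos (row x) (col x) x ≡ true
samePos-refl x = ∧-≡true⁺ (≡ᵇ-refl (row x)) (≡ᵇ-refl (col x))

samePos-≢ : ∀ {r c x} → (row x ≢ r ⊎ col x ≢ c) → samePos r c x ≡ false
samePos-≢ {r} {c} {x} differ with samePos r c x in same
... | false = refl
... | true with samePos-≡ {r} {c} {x} same | differ
...   | row≡ , _ | inj₁ row≢ = ⊥-elim (row≢ row≡)
...   | _ , col≡ | inj₂ col≢ = ⊥-elim (col≢ col≡)

samePos-false⇒≢ : ∀ {r c x} → samePos r c x ≡ false → row x ≢ r ⊎ col x ≢ c
samePos-false⇒≢ {r} {c} {x} different with row x ≟ r | col x ≟ c
... | yes refl | yes refl = ⊥-elim (false≢true different (samePos-refl x))
... | no row≢  | _        = inj₁ row≢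
... | yes _    | no col≢  = inj₂ col≢

ord≢ghost : just ord ≢ just ghost
ord≢ghost ()

CellAt : Diagram → ℕ → ℕ → Kind → Set
CellAt X r c k = ∃ λ x → x ∈ X × row x ≡ r × col x ≡ c × kind x ≡ k

at-just⇒CellAt : ∀ X {r c k} → at X r c ≡ just k → CellAt X r c k
at-just⇒CellAt (x ∷ X) {r} {c} found with samePos r c x in same
at-just⇒CellAt (x ∷ X) {r} {c} refl | true =
  let row≡ , col≡ = samePos-≡ {r} {c} {x} same in x , here refl , row≡ , col≡ , refl
... | false = let y , y∈ , rest = at-just⇒CellAt X found in y , there y∈ , rest

at-nothing⇒∉ : ∀ X {r c x} → at X r c ≡ nothing → x ∈ X → row x ≡ r → col x ≡ c → ⊥
at-nothing⇒∉ (y ∷ X) {r} {c} empty x∈ refl refl with samePos r c y in same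
at-nothing⇒∉ (y ∷ X) () x∈ refl refl | true
at-nothing⇒∉ (y ∷ X) empty (here refl) refl refl | false = false≢true same (samePos-refl y)
at-nothing⇒∉ (y ∷ X) empty (there x∈) refl refl | false = at-nothing⇒∉ X empty x∈ refl refl

∈⇒at-just : ∀ X {r c x} → x ∈ X → row x ≡ r → col x ≡ c → ∃ λ k → at X r c ≡ just k
∈⇒at-just X {r} {c} x∈ row≡ col≡ with at X r c in found
... | just k  = k , refl
... | nothing = ⊥-elim (at-nothing⇒∉ X found x∈ row≡ col≡)

isEmpty⇒at-nothing : ∀ X {r c} → isEmpty X r c ≡ true → at X r c ≡ nothing
isEmpty⇒at-nothing X {r} {c} empty with at X r c
... | nothing = refl

¬isEmpty⇒at-just : ∀ X {r c} → isEmpty X r c ≡ false → ∃ λ k → at X r c ≡ just k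
¬isEmpty⇒at-just X {r} {c} occupied with at X r c
... | just k = k , refl

at-nothing⇒isEmpty : ∀ X {r c} → at X r c ≡ nothing → isEmpty X r c ≡ true
at-nothing⇒isEmpty X empty rewrite empty = refl

at-just⇒¬isEmpty : ∀ X {r c k} → at X r c ≡ just k → isEmpty X r c ≡ false
at-just⇒¬isEmpty X occupied rewrite occupied = refl

-- at reports the first cell at a position; in a coherent diagram that is every cell there.
Coherent : Diagram → Set
Coherent X = ∀ x → x ∈ X → at X (row x) (col x) ≡ just (kind x)

CellAt⇒at : ∀ X {r c k} → Coherent X → CellAt X r c k → at X r c ≡ just k
CellAt⇒at X coherent (x , x∈ , refl , refl , refl) = coherent x x∈

isOrdinary : Diagram → ℕ → ℕ → Bool
isOrdinary X r c = maybe (λ k → not (isGhostK k)) false (at X r c)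

isOrdinary⇒at-ord : ∀ X q c → isOrdinary X q c ≡ true → at X q c ≡ just ord
isOrdinary⇒at-ord X q c ordinary with at X q c
... | just ord = refl

blocked : Diagram → ℕ → ℕ → Bool
blocked X r c = any (λ x → (row x ≡ᵇ r) ∧ (c <ᵇ col x)) X

blocked⇒∃ : ∀ X {r c} → blocked X r c ≡ true → ∃ λ x → x ∈ X × row x ≡ r × c < col x
blocked⇒∃ X {r} {c} blk with any-≡true⁻ (λ x → (row x ≡ᵇ r) ∧ (c <ᵇ col x)) X blk
... | x , x∈ , right = let row≡ , c< = ∧-≡true⁻ {row x ≡ᵇ r} right in x , x∈ , ≡ᵇ⇒≡′ row≡ , <ᵇ⇒<′ c<

∃⇒blocked : ∀ X {r c x} → x ∈ X → row x ≡ r → c < col x → blocked X r c ≡ true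
∃⇒blocked X {r} {c} {x} x∈ refl c<col =
  any-≡true⁺ (λ x → (row x ≡ᵇ r) ∧ (c <ᵇ col x)) x∈ (∧-≡true⁺ (≡ᵇ-refl (row x)) (<⇒<ᵇ′ c<col))

¬blocked⇒≤ : ∀ X {r c x} → blocked X r c ≡ false → x ∈ X → row x ≡ r → col x ≤ c
¬blocked⇒≤ X {r} {c} {x} free x∈ row≡ with c <? col x
... | yes c<col = ⊥-elim (false≢true free (∃⇒blocked X x∈ row≡ c<col))
... | no c≮col  = ≮⇒≥ c≮col

≤⇒¬blocked : ∀ X {r c} → (∀ x → x ∈ X → row x ≡ r → col x ≤ c) → blocked X r c ≡ false
≤⇒¬blocked X {r} {c} leftmost with blocked X r c in blk
... | false = refl
... | true  = let x , x∈ , row≡ , c<col = blocked⇒∃ X blk in ⊥-elim (<⇒≱ c<col (leftmost x x∈ row≡))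

movable : Diagram → ℕ → ℕ → Bool
movable X c q = isOrdinary X q c ∧ not (blocked X q c)

hole : Diagram → ℕ → ℕ → Bool
hole X c q = isEmpty X q c ∧ blocked X q c

RightmostIs : Diagram → ℕ → ℕ → Kind → Set
RightmostIs X r c k = CellAt X r c k × (∀ y → y ∈ X → row y ≡ r → col y ≤ c)

rightmost-nothing : ∀ X r → rightmost X r ≡ nothing → ∀ x → x ∈ X → row x ≢ r
rightmost-nothing (x ∷ X) r none y y∈ row≡ with rightmost X r in rest | row x ≡ᵇ r in row-x | y∈
... | nothing | false | here refl = false≢true row-x (subst (λ r → (row x ≡ᵇ r) ≡ true) row≡ (≡ᵇ-refl (row x)))
... | nothing | false | there y∈X = rightmost-nothing X r rest y y∈X row≡
rightmost-nothing (x ∷ X) r () y y∈ row≡ | just _ | false | _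
rightmost-nothing (x ∷ X) r () y y∈ row≡ | nothing | true | _
rightmost-nothing (x ∷ X) r none y y∈ row≡ | just (c , k) | true | _ with c <ᵇ col x
rightmost-nothing (x ∷ X) r () y y∈ row≡ | just (c , k) | true | _ | true
rightmost-nothing (x ∷ X) r () y y∈ row≡ | just (c , k) | true | _ | false

rightmost-just : ∀ X r {c k} → rightmost X r ≡ just (c , k) → RightmostIs X r c k
rightmost-just (x ∷ X) r found with rightmost X r in rest | row x ≡ᵇ r in row-x
rightmost-just (x ∷ X) r () | nothing | false
rightmost-just (x ∷ X) r refl | just _ | false = skip-x (rightmost-just X r rest)
  where
  skip-x : ∀ {c k} → RightmostIs X r c k → RightmostIs (x ∷ X) r c k
  skip-x ((y , y∈ , at-y) , bound) = (y , there y∈ , at-y) , λ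
    { z (here refl) row≡ → ⊥-elim (false≢true row-x (subst (λ r → (row x ≡ᵇ r) ≡ true) row≡ (≡ᵇ-refl (row x))))
    ; z (there z∈) row≡ → bound z z∈ row≡ }
rightmost-just (x ∷ X) r refl | nothing | true =
  (x , here refl , ≡ᵇ⇒≡′ row-x , refl , refl) , λ
    { y (here refl) _ → ≤-refl
    ; y (there y∈) row≡ → ⊥-elim (rightmost-nothing X r rest y y∈ row≡) }
rightmost-just (x ∷ X) r found | just (c′ , k′) | true with c′ <ᵇ col x in c′<col | found
... | true | refl =
  (x , here refl , ≡ᵇ⇒≡′ row-x , refl , refl) , λ
    { y (here refl) _ → ≤-refl
    ; y (there y∈) row≡ → ≤-trans (proj₂ (rightmost-just X r rest) y y∈ row≡) (<⇒≤ (<ᵇ⇒<′ c′<col)) }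
... | false | refl =
  let (y , y∈ , at-y) , bound = rightmost-just X r rest in
  (y , there y∈ , at-y) , λ
    { z (here refl) _ → <ᵇ≡false⇒≥ c′<col
    ; z (there z∈) row≡ → bound z z∈ row≡ }

rightmost-ordinary : ∀ X r c → Coherent X → at X r c ≡ just ord → blocked X r c ≡ false →
                     rightmost X r ≡ just (c , ord)
rightmost-ordinary X r c coherent ordinary unblocked with rightmost X r in found
... | nothing = let x , x∈ , row≡ , _ = at-just⇒CellAt X ordinary in ⊥-elim (rightmost-nothing X r found x x∈ row≡)
... | just (c′ , k′) with rightmost-just X r found | at-just⇒CellAt X ordinary
...   | (y , y∈ , refl , refl , refl) , bound | x , x∈ , refl , refl , x-ord = cong just (cong₂ _,_ c′≡c k′≡ord)
  where
  c′≡c : col y ≡ col x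
  c′≡c = ≤-antisym (¬blocked⇒≤ X unblocked y∈ refl) (bound x x∈ refl)
  k′≡ord : kind y ≡ ord
  k′≡ord = just-injective (trans (sym (coherent y y∈)) (subst (λ c → at X (row y) c ≡ just ord) (sym c′≡c) ordinary))

HighestEmpty : Diagram → ℕ → ℕ → ℕ → Set
HighestEmpty X c k r̂ =
  1 ≤ r̂ × r̂ ≤ k × isEmpty X r̂ c ≡ true × (∀ q → r̂ < q → q ≤ k → isEmpty X q c ≡ false)

maxEmptyBelow-just : ∀ X c k {r̂} → maxEmptyBelow X c k ≡ just r̂ → HighestEmpty X c k r̂
maxEmptyBelow-just X c (suc k) found with isEmpty X (suc k) c in empty
maxEmptyBelow-just X c (suc k) refl | true = s≤s z≤n , ≤-refl , empty , λ q k<q q≤k → ⊥-elim (<⇒≱ k<q q≤k)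
... | false with maxEmptyBelow-just X c k found
...   | 1≤r̂ , r̂≤k , r̂-empty , above = 1≤r̂ , m≤n⇒m≤1+n r̂≤k , r̂-empty , above′
  where
  above′ : ∀ q → _ < q → q ≤ suc k → isEmpty X q c ≡ false
  above′ q r̂<q q≤k+1 with q ≟ suc k
  ... | yes refl = empty
  ... | no q≢k+1 = above q r̂<q (≤-pred (≤∧≢⇒< q≤k+1 q≢k+1))

HighestEmpty⇒maxEmptyBelow : ∀ X c k r̂ → HighestEmpty X c k r̂ → maxEmptyBelow X c k ≡ just r̂
HighestEmpty⇒maxEmptyBelow X c zero r̂ (1≤r̂ , r̂≤0 , _) = ⊥-elim (<⇒≱ 1≤r̂ r̂≤0)
HighestEmpty⇒maxEmptyBelow X c (suc k) r̂ (1≤r̂ , r̂≤k+1 , r̂-empty , above) with r̂ ≟ suc k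
... | yes refl rewrite r̂-empty = refl
... | no r̂≢k+1 rewrite above (suc k) (≤∧≢⇒< r̂≤k+1 r̂≢k+1) ≤-refl =
  HighestEmpty⇒maxEmptyBelow X c k r̂
    (1≤r̂ , ≤-pred (≤∧≢⇒< r̂≤k+1 r̂≢k+1) , r̂-empty , λ q r̂<q q≤k → above q r̂<q (m≤n⇒m≤1+n q≤k))

∈-openRange⁻ : ∀ a b q → q ∈ openRange a b → a < q × q < b
∈-openRange⁻ a b q q∈ with ∈-map⁻ (suc a +_) q∈
... | i , i∈ , refl = s≤s (m≤m+n a i) , subst (suc a + i <_) (m+[n∸m]≡n a<b) (+-monoʳ-< (suc a) i<)
  where
  i< : i < b ∸ suc a
  i< = ∈-upTo⁻ i∈
  a<b : suc a ≤ b
  a<b with suc a ≤? b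
  ... | yes a<b = a<b
  ... | no a≮b = ⊥-elim (<⇒≱ i< (≤-trans (≤-reflexive (m≤n⇒m∸n≡0 (<⇒≤ (≰⇒> a≮b)))) z≤n))

∈-openRange⁺ : ∀ a b q → a < q → q < b → q ∈ openRange a b
∈-openRange⁺ a b q a<q q<b =
  subst (_∈ openRange a b) (m+[n∸m]≡n a<q) (∈-map⁺ (suc a +_) (∈-upTo⁺ (∸-monoˡ-< q<b a<q)))

noGhostBetween⁻ : ∀ X c a b → any (λ q → isGhostAt X q c) (openRange a b) ≡ false →
                  ∀ q → a < q → q < b → isGhostAt X q c ≡ false
noGhostBetween⁻ X c a b none q a<q q<b with isGhostAt X q c in ghost
... | false = refl
... | true  = ⊥-elim (false≢true none (any-≡true⁺ (λ q → isGhostAt X q c) (∈-openRange⁺ a b q a<q q<b) ghost))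

noGhostBetween⁺ : ∀ X c a b → (∀ q → a < q → q < b → isGhostAt X q c ≡ false) →
                  any (λ q → isGhostAt X q c) (openRange a b) ≡ false
noGhostBetween⁺ X c a b none =
  any-≡false⁺ (λ q → isGhostAt X q c) (openRange a b)
    (λ q q∈ → let a<q , q<b = ∈-openRange⁻ a b q q∈ in none q a<q q<b)

module Relocation (r c r̂ : ℕ) where

  shift : Cell → Cell
  shift x = if samePos r c x then cell r̂ c (kind x) else x

  shift-cases : ∀ x → (samePos r c x ≡ true × shift x ≡ cell r̂ c (kind x)) ⊎ (samePos r c x ≡ false × shift x ≡ x)
  shift-cases x with samePos r c x
  ... | true  = inj₁ (refl , refl)
  ... | false = inj₂ (refl , refl)

  source-not-at : ∀ {x p q} → samePos r c x ≡ true → (p ≢ r ⊎ q ≢ c) → samePos p q x ≡ false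
  source-not-at {x} at-source ≢source with samePos-≡ {r} {c} {x} at-source
  ... | refl , refl = samePos-≢ {x = x} (Data.Sum.map ≢-sym ≢-sym ≢source)

  at-shift-other : ∀ X p q → (p ≢ r ⊎ q ≢ c) → (p ≢ r̂ ⊎ q ≢ c) → at (map shift X) p q ≡ at X p q
  at-shift-other [] p q _ _ = refl
  at-shift-other (x ∷ X) p q ≢source ≢target with shift-cases x
  ... | inj₂ (_ , shift-x) rewrite shift-x with samePos p q x
  ...   | true  = refl
  ...   | false = at-shift-other X p q ≢source ≢target
  at-shift-other (x ∷ X) p q ≢source ≢target | inj₁ (at-source , shift-x)
    rewrite shift-x | samePos-≢ {p} {q} {cell r̂ c (kind x)} (Data.Sum.map ≢-sym ≢-sym ≢target)
          | source-not-at {x} {p} {q} at-source ≢source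
    = at-shift-other X p q ≢source ≢target

  at-shift-target : ∀ X → r̂ ≢ r → at X r̂ c ≡ nothing → at (map shift X) r̂ c ≡ at X r c
  at-shift-target [] _ _ = refl
  at-shift-target (x ∷ X) r̂≢r empty with shift-cases x
  ... | inj₁ (at-source , shift-x) rewrite shift-x | ≡ᵇ-refl r̂ | ≡ᵇ-refl c | at-source = refl
  ... | inj₂ (not-source , shift-x) rewrite shift-x | not-source with samePos r̂ c x
  ...   | false = at-shift-target X r̂≢r empty

  ghosts-shift : ∀ X → ghosts (map shift X) ≡ ghosts X
  ghosts-shift [] = refl
  ghosts-shift (x ∷ X) with shift-cases x
  ... | inj₂ (_ , shift-x) rewrite shift-x with isGhostK (kind x)
  ...   | true  = cong suc (ghosts-shift X)
  ...   | false = ghosts-shift X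
  ghosts-shift (x ∷ X) | inj₁ (_ , shift-x) rewrite shift-x with isGhostK (kind x)
  ...   | true  = cong suc (ghosts-shift X)
  ...   | false = ghosts-shift X

  ∈-shift⁻ : ∀ X {y} → y ∈ map shift X →
             ∃ λ x → x ∈ X × ((samePos r c x ≡ true × y ≡ cell r̂ c (kind x)) ⊎ (samePos r c x ≡ false × y ≡ x))
  ∈-shift⁻ X y∈ with ∈-map⁻ shift y∈
  ... | x , x∈ , refl = x , x∈ , shift-cases x

open Relocation using (shift; shift-cases; ∈-shift⁻)

at-relocate-source : ∀ X r c r̂ → at (relocate r c r̂ X) r c ≡ just ghost
at-relocate-source X r c r̂ rewrite ≡ᵇ-refl r | ≡ᵇ-refl c = refl

at-relocate-target : ∀ X r c r̂ → r̂ ≢ r → at X r̂ c ≡ nothing → at (relocate r c r̂ X) r̂ c ≡ at X r c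
at-relocate-target X r c r̂ r̂≢r empty rewrite ≢⇒≡ᵇ≡false (≢-sym r̂≢r) =
  Relocation.at-shift-target r c r̂ X r̂≢r empty

at-relocate-other : ∀ X r c r̂ p q → (p ≢ r ⊎ q ≢ c) → (p ≢ r̂ ⊎ q ≢ c) →
                    at (relocate r c r̂ X) p q ≡ at X p q
at-relocate-other X r c r̂ p q ≢source ≢target
  rewrite samePos-≢ {p} {q} {cell r c ghost} (Data.Sum.map ≢-sym ≢-sym ≢source) =
  Relocation.at-shift-other r c r̂ X p q ≢source ≢target

ghosts-relocate : ∀ X r c r̂ → ghosts (relocate r c r̂ X) ≡ suc (ghosts X)
ghosts-relocate X r c r̂ = cong suc (Relocation.ghosts-shift r c r̂ X)

blocked-relocate⁻ : ∀ X r c r̂ p q {k} → at X r c ≡ just k → blocked (relocate r c r̂ X) p q ≡ true →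
                    blocked X p q ≡ true ⊎ (p ≡ r̂ × q < c)
blocked-relocate⁻ X r c r̂ p q source blk with blocked⇒∃ (relocate r c r̂ X) blk
... | y , here refl , refl , q<c =
  let x , x∈ , row≡ , col≡ , _ = at-just⇒CellAt X source in
  inj₁ (∃⇒blocked X x∈ row≡ (subst (q <_) (sym col≡) q<c))
... | y , there y∈ , refl , q<col with ∈-shift⁻ r c r̂ X y∈
...   | x , x∈ , inj₁ (_ , refl) = inj₂ (refl , q<col)
...   | x , x∈ , inj₂ (_ , refl) = inj₁ (∃⇒blocked X x∈ refl q<col)

blocked-relocate⁺ : ∀ X r c r̂ p q {k} → at X r c ≡ just k → blocked X p q ≡ true ⊎ (p ≡ r̂ × q < c) →
                    blocked (relocate r c r̂ X) p q ≡ true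
blocked-relocate⁺ X r c r̂ p q source (inj₁ blk) with blocked⇒∃ X blk
... | x , x∈ , refl , q<col with shift-cases r c r̂ x
...   | inj₁ (at-source , _) = let row≡ , col≡ = samePos-≡ {r} {c} {x} at-source in
  ∃⇒blocked (relocate r c r̂ X) (here refl) (sym row≡) (subst (q <_) col≡ q<col)
...   | inj₂ (_ , shift-x) =
  ∃⇒blocked (relocate r c r̂ X) (there (subst (_∈ map (shift r c r̂) X) shift-x (∈-map⁺ (shift r c r̂) x∈))) refl q<col
blocked-relocate⁺ X r c r̂ p q source (inj₂ (refl , q<c)) with at-just⇒CellAt X source
... | x , x∈ , row≡ , col≡ , _ with shift-cases r c r̂ x
...   | inj₂ (not-source , _) =
  ⊥-elim (false≢true not-source (subst₂ (λ r c → samePos r c x ≡ true) row≡ col≡ (samePos-refl x)))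
...   | inj₁ (_ , shift-x) =
  ∃⇒blocked (relocate r c r̂ X) (there (subst (_∈ map (shift r c r̂) X) shift-x (∈-map⁺ (shift r c r̂) x∈))) refl q<c

Coherent-relocate : ∀ X r c r̂ → Coherent X → r̂ ≢ r → at X r̂ c ≡ nothing → Coherent (relocate r c r̂ X)
Coherent-relocate X r c r̂ coherent r̂≢r empty y (here refl) = at-relocate-source X r c r̂
Coherent-relocate X r c r̂ coherent r̂≢r empty y (there y∈) with ∈-shift⁻ r c r̂ X y∈
... | x , x∈ , inj₁ (at-source , refl) with samePos-≡ {r} {c} {x} at-source
...   | refl , refl = trans (at-relocate-target X r c r̂ r̂≢r empty) (coherent x x∈)
Coherent-relocate X r c r̂ coherent r̂≢r empty y (there y∈) | x , x∈ , inj₂ (not-source , refl) =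
  trans (at-relocate-other X r c r̂ (row x) (col x) (samePos-false⇒≢ {x = x} not-source) ≢target) (coherent x x∈)
  where
  ≢target : row x ≢ r̂ ⊎ col x ≢ c
  ≢target with row x ≟ r̂ | col x ≟ c
  ... | yes row≡ | yes col≡ = ⊥-elim (at-nothing⇒∉ X empty x∈ row≡ col≡)
  ... | no row≢  | _        = inj₁ row≢
  ... | yes _    | no col≢  = inj₂ col≢

record LegalMove (X : Diagram) (r c r̂ : ℕ) : Set where
  field
    source-ord       : at X r c ≡ just ord
    source-unblocked : blocked X r c ≡ false
    r̂<r              : r̂ < r
    1≤r̂              : 1 ≤ r̂
    target-empty     : at X r̂ c ≡ nothing
    between-ord      : ∀ q → r̂ < q → q < r → at X q c ≡ just ord

≤r∸1⇒< : ∀ {q r} → 1 ≤ q → q ≤ r ∸ 1 → q < r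
≤r∸1⇒< {r = zero}  1≤q q≤0 = ⊥-elim (<⇒≱ 1≤q q≤0)
≤r∸1⇒< {r = suc r} _   q≤r = s≤s q≤r

<⇒≤r∸1 : ∀ {q r} → q < r → q ≤ r ∸ 1
<⇒≤r∸1 {r = suc r} (s≤s q≤r) = q≤r

ghostMove-cases : ∀ X r → Coherent X →
                  ghostMove r X ≡ X ⊎ (∃ λ c → ∃ λ r̂ → LegalMove X r c r̂ × ghostMove r X ≡ relocate r c r̂ X)
ghostMove-cases X r coherent with rightmost X r in rm
... | nothing          = inj₁ refl
... | just (c , ghost) = inj₁ refl
... | just (c , ord) with maxEmptyBelow X c (r ∸ 1) in meb
...   | nothing = inj₁ refl
...   | just r̂ with any (λ q → isGhostAt X q c) (openRange r̂ r) in ghost-between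
...     | true  = inj₁ refl
...     | false = inj₂ (c , r̂ , legal , refl)
  where
  source = rightmost-just X r rm
  highest = maxEmptyBelow-just X c (r ∸ 1) meb
  legal : LegalMove X r c r̂
  legal = record
    { source-ord       = CellAt⇒at X coherent (proj₁ source)
    ; source-unblocked = ≤⇒¬blocked X (proj₂ source)
    ; r̂<r              = ≤r∸1⇒< (proj₁ highest) (proj₁ (proj₂ highest))
    ; 1≤r̂              = proj₁ highest
    ; target-empty     = isEmpty⇒at-nothing X (proj₁ (proj₂ (proj₂ highest)))
    ; between-ord      = between
    }
    where
    between : ∀ q → r̂ < q → q < r → at X q c ≡ just ord
    between q r̂<q q<r with ¬isEmpty⇒at-just X (proj₂ (proj₂ (proj₂ highest)) q r̂<q (<⇒≤r∸1 q<r))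
                         | noGhostBetween⁻ X c r̂ r ghost-between q r̂<q q<r
    ... | ord , at-q   | _ = at-q
    ... | ghost , at-q | not-ghost rewrite at-q = ⊥-elim (false≢true not-ghost refl)

LegalMove⇒HighestEmpty : ∀ {X r c r̂} → LegalMove X r c r̂ → HighestEmpty X c (r ∸ 1) r̂
LegalMove⇒HighestEmpty {X} legal =
  1≤r̂ , <⇒≤r∸1 r̂<r , at-nothing⇒isEmpty X target-empty ,
  λ q r̂<q q≤r-1 → at-just⇒¬isEmpty X (between-ord q r̂<q (≤r∸1⇒< (≤-trans 1≤r̂ (<⇒≤ r̂<q)) q≤r-1))
  where open LegalMove legal

ghostMove-legal : ∀ X r c r̂ → Coherent X → LegalMove X r c r̂ → ghostMove r X ≡ relocate r c r̂ X
ghostMove-legal X r c r̂ coherent legal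
  with rightmost X r | rightmost-ordinary X r c coherent (LegalMove.source-ord legal) (LegalMove.source-unblocked legal)
... | _ | refl with maxEmptyBelow X c (r ∸ 1) | HighestEmpty⇒maxEmptyBelow X c (r ∸ 1) r̂ (LegalMove⇒HighestEmpty legal)
...   | _ | refl
  rewrite noGhostBetween⁺ X c r̂ r (λ q r̂<q q<r → cong (maybe isGhostK false) (LegalMove.between-ord legal q r̂<q q<r))
  = refl

module LegalMoveEffect (X : Diagram) (r c r̂ : ℕ) (legal : LegalMove X r c r̂) where
  open LegalMove legal

  X′ : Diagram
  X′ = relocate r c r̂ X

  at′-source : at X′ r c ≡ just ghost
  at′-source = at-relocate-source X r c r̂

  at′-target : at X′ r̂ c ≡ just ord
  at′-target = trans (at-relocate-target X r c r̂ (<⇒≢ r̂<r) target-empty) source-ord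

  at′-otherRow : ∀ q → q ≢ r → q ≢ r̂ → at X′ q c ≡ at X q c
  at′-otherRow q q≢r q≢r̂ = at-relocate-other X r c r̂ q c (inj₁ q≢r) (inj₁ q≢r̂)

  at′-otherCol : ∀ q c′ → c′ ≢ c → at X′ q c′ ≡ at X q c′
  at′-otherCol q c′ c′≢c = at-relocate-other X r c r̂ q c′ (inj₂ c′≢c) (inj₂ c′≢c)

  blocked′⁻ : ∀ q c′ → blocked X′ q c′ ≡ true → blocked X q c′ ≡ true ⊎ (q ≡ r̂ × c′ < c)
  blocked′⁻ q c′ = blocked-relocate⁻ X r c r̂ q c′ source-ord

  blocked′⁺ : ∀ q c′ → blocked X q c′ ≡ true → blocked X′ q c′ ≡ true
  blocked′⁺ q c′ blk = blocked-relocate⁺ X r c r̂ q c′ source-ord (inj₁ blk)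

  blocked′-unchanged : ∀ q c′ → c ≤ c′ → blocked X′ q c′ ≡ blocked X q c′
  blocked′-unchanged q c′ c≤c′ with blocked X q c′ in blk
  ... | true  = blocked′⁺ q c′ blk
  ... | false with blocked X′ q c′ in blk′
  ...   | false = refl
  ...   | true with blocked′⁻ q c′ blk′
  ...     | inj₁ blk-true = ⊥-elim (false≢true blk blk-true)
  ...     | inj₂ (_ , c′<c) = ⊥-elim (<⇒≱ c′<c c≤c′)

  columnMove : ColumnMove (movable X c) (hole X c) (movable X′ c) (hole X′ c) (blocked X r̂ c) r r̂
  columnMove = record
    { O-r       = O-r
    ; r̂<r       = r̂<r
    ; H-r̂       = H-r̂
    ; H-between = H-between
    ; O-r̂       = O-r̂
    ; O′-r      = O′-r
    ; O′-r̂      = O′-r̂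
    ; O′-other  = O′-other
    ; H′-r̂      = H′-r̂
    ; H′-other  = H′-other
    }
    where
    O-r : movable X c r ≡ true
    O-r rewrite source-ord | source-unblocked = refl
    H-r̂ : hole X c r̂ ≡ blocked X r̂ c
    H-r̂ rewrite target-empty = refl
    H-between : ∀ q → r̂ < q → q < r → hole X c q ≡ false
    H-between q r̂<q q<r rewrite between-ord q r̂<q q<r = refl
    O-r̂ : movable X c r̂ ≡ false
    O-r̂ rewrite target-empty = refl
    O′-r : movable X′ c r ≡ false
    O′-r rewrite at′-source = refl
    O′-r̂ : movable X′ c r̂ ≡ not (blocked X r̂ c)
    O′-r̂ rewrite at′-target | blocked′-unchanged r̂ c ≤-refl = refl
    O′-other : ∀ q → q ≢ r → q ≢ r̂ → movable X′ c q ≡ movable X c q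
    O′-other q q≢r q≢r̂ rewrite at′-otherRow q q≢r q≢r̂ | blocked′-unchanged q c ≤-refl = refl
    H′-r̂ : hole X′ c r̂ ≡ false
    H′-r̂ rewrite at′-target = refl
    H′-other : ∀ q → q ≢ r̂ → hole X′ c q ≡ hole X c q
    H′-other q q≢r̂ with q ≟ r
    ... | yes refl rewrite source-ord | at′-source = refl
    ... | no q≢r rewrite at′-otherRow q q≢r q≢r̂ | blocked′-unchanged q c ≤-refl = refl

  movable′-⊆ : ∀ c′ → c′ ≢ c → ∀ q → movable X′ c′ q ≡ true → movable X c′ q ≡ true
  movable′-⊆ c′ c′≢c q mov′ with ∧-≡true⁻ {isOrdinary X′ q c′} mov′
  ... | ordinary′ , unblocked′ =
    ∧-≡true⁺ (trans (cong (maybe (λ k → not (isGhostK k)) false) (sym (at′-otherCol q c′ c′≢c))) ordinary′)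
             (not-≡true⁺ unblocked)
    where
    unblocked : blocked X q c′ ≡ false
    unblocked with blocked X q c′ in blk
    ... | false = refl
    ... | true  = ⊥-elim (false≢true (not-≡true⁻ unblocked′) (blocked′⁺ q c′ blk))

  hole-⊆ : ∀ c′ → c′ ≢ c → ∀ q → hole X c′ q ≡ true → hole X′ c′ q ≡ true
  hole-⊆ c′ c′≢c q hole-q with ∧-≡true⁻ {isEmpty X q c′} hole-q
  ... | empty , blk =
    ∧-≡true⁺ (trans (cong (maybe (λ _ → false) true) (at′-otherCol q c′ c′≢c)) empty) (blocked′⁺ q c′ blk)

  movable′-right : ∀ c′ q → c < c′ → movable X′ c′ q ≡ movable X c′ q
  movable′-right c′ q c<c′ rewrite at′-otherCol q c′ (>⇒≢ c<c′) | blocked′-unchanged q c′ (<⇒≤ c<c′) = refl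

  hole′-right : ∀ c′ q → c < c′ → hole X′ c′ q ≡ hole X c′ q
  hole′-right c′ q c<c′ rewrite at′-otherCol q c′ (>⇒≢ c<c′) | blocked′-unchanged q c′ (<⇒≤ c<c′) = refl

-- Snowflakes of D

lookupL⇒∈ : ∀ acc {k l} → lookupL k acc ≡ just l → (k , l) ∈ acc
lookupL⇒∈ ((k′ , l′) ∷ acc) {k} found with k′ ≡ᵇ k in k′≡k
lookupL⇒∈ ((k′ , l′) ∷ acc) {k} refl | true rewrite ≡ᵇ⇒≡′ {k′} k′≡k = here refl
... | false = there (lookupL⇒∈ acc found)

∈⇒lookupL : ∀ acc {k l} → (k , l) ∈ acc → ∃ λ l′ → lookupL k acc ≡ just l′ × (k , l′) ∈ acc
∈⇒lookupL ((k′ , l′) ∷ acc) {k} kl∈ with k′ ≡ᵇ k in k′≡k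
... | true rewrite ≡ᵇ⇒≡′ {k′} k′≡k = l′ , refl , here refl
∈⇒lookupL ((k′ , l′) ∷ acc) {k} (here refl) | false = ⊥-elim (false≢true k′≡k (≡ᵇ-refl k))
∈⇒lookupL ((k′ , l′) ∷ acc) {k} (there kl∈) | false =
  let l″ , found , kl″∈ = ∈⇒lookupL acc kl∈ in l″ , found , there kl″∈

snowWitness : Diagram → ℕ → ℕ → Cell → Bool
snowWitness D e c x = (col x ≡ᵇ c) ∧ (e <ᵇ row x) ∧ maybe (λ l → l ≤ᵇ e) false (label D (row x) c)

module ColumnOf (D : Diagram) (noGhost : NoGhost D) (rows-pos : ∀ x → x ∈ D → 1 ≤ row x) (c : ℕ) where

  ∈-rowsOf⁻ : ∀ {q} → q ∈ rowsOf D c → ∃ λ x → x ∈ D × row x ≡ q × col x ≡ c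
  ∈-rowsOf⁻ q∈ with ∈-map⁻ row q∈
  ... | x , x∈ , refl =
    let x∈D , col≡ = ∈-filterᵇ⁻ (λ x → col x ≡ᵇ c) D x∈ in x , x∈D , refl , ≡ᵇ⇒≡′ col≡

  ∈-rowsOf⁺ : ∀ {x} → x ∈ D → col x ≡ c → row x ∈ rowsOf D c
  ∈-rowsOf⁺ {x} x∈ refl = ∈-map⁺ row (∈-filterᵇ⁺ (λ x → col x ≡ᵇ c) x∈ (≡ᵇ-refl (col x)))

  0∉rows : memb 0 (rowsOf D c) ≡ false
  0∉rows with memb 0 (rowsOf D c) in found
  ... | false = refl
  ... | true  =
    let x , x∈ , row≡ , _ = ∈-rowsOf⁻ (memb⇒∈ found) in ⊥-elim (<⇒≱ (rows-pos x x∈) (≤-reflexive row≡))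

  open Labelling (rowsOf D c) (rowsRight D c) 0∉rows public

  inR≡occupied : ∀ q → inR q ≡ not (isEmpty D q c)
  inR≡occupied q = bool-ext occupied⇒ ⇒occupied
    where
    occupied⇒ : inR q ≡ true → not (isEmpty D q c) ≡ true
    occupied⇒ inR-q = let x , x∈ , row≡ , col≡ = ∈-rowsOf⁻ (memb⇒∈ inR-q) in
                      not-≡true⁺ (at-just⇒¬isEmpty D (proj₂ (∈⇒at-just D x∈ row≡ col≡)))
    ⇒occupied : not (isEmpty D q c) ≡ true → inR q ≡ true
    ⇒occupied occ =
      let k , at-q = ¬isEmpty⇒at-just D (not-≡true⁻ occ)
          x , x∈ , row≡ , col≡ , _ = at-just⇒CellAt D at-q
      in ∈⇒memb (subst (_∈ rowsOf D c) row≡ (∈-rowsOf⁺ x∈ col≡))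

  inU≡blocked : ∀ q → inU q ≡ blocked D q c
  inU≡blocked q = bool-ext inU⇒ ⇒inU
    where
    inU⇒ : inU q ≡ true → blocked D q c ≡ true
    inU⇒ inU-q with ∈-map⁻ row (memb⇒∈ {xs = rowsRight D c} inU-q)
    ... | x , x∈ , refl =
      let x∈D , c<col = ∈-filterᵇ⁻ (λ x → c <ᵇ col x) D x∈ in ∃⇒blocked D x∈D refl (<ᵇ⇒<′ c<col)
    ⇒inU : blocked D q c ≡ true → inU q ≡ true
    ⇒inU blk with blocked⇒∃ D blk
    ... | x , x∈ , refl , c<col = ∈⇒memb (∈-map⁺ row (∈-filterᵇ⁺ (λ x → c <ᵇ col x) x∈ (<⇒<ᵇ′ c<col)))

  isOrdinary≡occupied : ∀ q → isOrdinary D q c ≡ not (isEmpty D q c)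
  isOrdinary≡occupied q with at D q c in at-q
  ... | nothing = refl
  ... | just k with at-just⇒CellAt D at-q
  ...   | x , x∈ , _ , _ , refl rewrite All.lookup noGhost x∈ = refl

  movable≡O : ∀ q → movable D c q ≡ O q
  movable≡O q rewrite isOrdinary≡occupied q | inR≡occupied q | inU≡blocked q = refl

  hole≡H : ∀ q → hole D c q ≡ H q
  hole≡H q rewrite inR≡occupied q | inU≡blocked q with isEmpty D q c
  ... | true  = refl
  ... | false = refl

  snowWitness⇒Snow : ∀ e → any (snowWitness D e c) D ≡ true → Snow (labelsCol (rowsOf D c) (rowsRight D c)) e
  snowWitness⇒Snow e found with any-≡true⁻ (snowWitness D e c) D found
  ... | x , x∈ , witness with ∧-≡true⁻ {col x ≡ᵇ c} witness
  ...   | _ , above-and-label with ∧-≡true⁻ {e <ᵇ row x} above-and-label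
  ...     | e<row , label≤e with label D (row x) c in label-x
  ...       | just l = row x , l , lookupL⇒∈ _ label-x , <ᵇ⇒<′ e<row , ≤ᵇ⇒≤′ label≤e

  Snow⇒snowWitness : ∀ e → Snow (labelsCol (rowsOf D c) (rowsRight D c)) e → any (snowWitness D e c) D ≡ true
  Snow⇒snowWitness e (k , l , kl∈ , e<k , l≤e)
    with ∈-rowsOf⁻ (memb⇒∈ (proj₁ (Invariant.labelled-inR invariant-labels k l kl∈)))
  ... | x , x∈ , refl , col≡ with ∈⇒lookupL _ kl∈
  ...   | l′ , found , kl′∈ =
    any-≡true⁺ (snowWitness D e c) x∈
      (∧-≡true⁺ (trans (cong (_≡ᵇ c) col≡) (≡ᵇ-refl c)) (∧-≡true⁺ (<⇒<ᵇ′ e<k) label≤e))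
    where
    label≤e : maybe (λ l → l ≤ᵇ e) false (label D (row x) c) ≡ true
    label≤e rewrite found =
      ≤⇒≤ᵇ′ (subst (_≤ e) (Invariant.label-unique invariant-labels (row x) l l′ kl∈ kl′∈) l≤e)

  Hall-D⇒Hall-OH : ∀ e → Hall (movable D c) (hole D c) e → Hall O H e
  Hall-D⇒Hall-OH e = Hall-cong e (λ q _ → movable≡O q) (λ q _ → hole≡H q)

  Hall-OH⇒Hall-D : ∀ e → Hall O H e → Hall (movable D c) (hole D c) e
  Hall-OH⇒Hall-D e = Hall-cong e (λ q _ → sym (movable≡O q)) (λ q _ → sym (hole≡H q))

  isSnow⇒¬Hall : ∀ e → isSnow D e c ≡ true →
                 1 ≤ e × 1 ≤ c × isEmpty D e c ≡ true × ¬ Hall (movable D c) (hole D c) e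
  isSnow⇒¬Hall e snow with ∧-≡true⁻ {1 ≤ᵇ e} snow
  ... | 1≤e , rest with ∧-≡true⁻ {1 ≤ᵇ c} rest
  ...   | 1≤c , rest′ with ∧-≡true⁻ {isEmpty D e c} rest′
  ...     | empty , witness =
    ≤ᵇ⇒≤′ 1≤e , ≤ᵇ⇒≤′ 1≤c , empty ,
    λ hall → labels-snow⇒¬Hall e (≤ᵇ⇒≤′ 1≤e) (snowWitness⇒Snow e witness) (Hall-D⇒Hall-OH e hall)

  ¬Hall⇒isSnow : ∀ e → 1 ≤ e → 1 ≤ c → isEmpty D e c ≡ true → ¬ Hall (movable D c) (hole D c) e →
                 isSnow D e c ≡ true
  ¬Hall⇒isSnow e 1≤e 1≤c empty ¬hall with any (snowWitness D e c) D in witness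
  ... | false =
    ⊥-elim (¬hall (Hall-OH⇒Hall-D e
                    (labels-¬snow⇒Hall e 1≤e (λ snowy → false≢true witness (Snow⇒snowWitness e snowy)))))
  ... | true rewrite ≤⇒≤ᵇ′ 1≤e | ≤⇒≤ᵇ′ 1≤c | empty = refl

countᴸ : ∀ {A : Set} → (A → Bool) → List A → ℕ
countᴸ h L = length (filter (T? ∘ h) L)

module _ {A : Set} where

  countᴸ-cong : ∀ (h h′ : A → Bool) L → (∀ x → x ∈ L → h x ≡ h′ x) → countᴸ h L ≡ countᴸ h′ L
  countᴸ-cong h h′ [] _ = refl
  countᴸ-cong h h′ (x ∷ L) h≡h′ with h x | h′ x | h≡h′ x (here refl)
  ... | true  | true  | _ = cong suc (countᴸ-cong h h′ L (λ y y∈ → h≡h′ y (there y∈)))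
  ... | false | false | _ = countᴸ-cong h h′ L (λ y y∈ → h≡h′ y (there y∈))

  countᴸ-remove : ∀ (h h′ : A → Bool) {p} L → Unique L → p ∈ L → (∀ x → x ≢ p → h x ≡ h′ x) →
                  h p ≡ true → h′ p ≡ false → countᴸ h L ≡ suc (countᴸ h′ L)
  countᴸ-remove h h′ (x ∷ L) (x∉L ∷ _) (here refl) same hp h′p rewrite hp | h′p =
    cong suc (countᴸ-cong h h′ L (λ y y∈ → same y (≢-sym (All.lookup x∉L y∈))))
  countᴸ-remove h h′ (x ∷ L) (x∉L ∷ unique) (there p∈) same hp h′p with h x | h′ x | same x (All.lookup x∉L p∈)
  ... | true  | true  | _ = cong suc (countᴸ-remove h h′ L unique p∈ same hp h′p)
  ... | false | false | _ = countᴸ-remove h h′ L unique p∈ same hp h′p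

  countᴸ-suc⇒∃ : ∀ (h : A → Bool) L {n} → countᴸ h L ≡ suc n → ∃ λ x → x ∈ L × h x ≡ true
  countᴸ-suc⇒∃ h (x ∷ L) count≡ with h x in hx
  ... | true  = x , here refl , hx
  ... | false = let y , y∈ , hy = countᴸ-suc⇒∃ h L count≡ in y , there y∈ , hy

concatMap-pairs : ∀ {A B : Set} (xs : List A) (ys : List B) →
                  concatMap (λ x → map (λ y → x , y) ys) xs ≡ cartesianProduct xs ys
concatMap-pairs []       ys = refl
concatMap-pairs (x ∷ xs) ys = cong (map (x ,_) ys ++_) (concatMap-pairs xs ys)

positions-unique : ∀ D → Unique (positions D)
positions-unique D = subst Unique (sym (concatMap-pairs (upTo (suc (maxRow D))) (upTo (suc (maxCol D)))))
                       (cartesianProduct⁺ (upTo⁺ (suc (maxRow D))) (upTo⁺ (suc (maxCol D))))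

∈-positions : ∀ D q c → q ≤ maxRow D → c ≤ maxCol D → (q , c) ∈ positions D
∈-positions D q c q≤ c≤ = subst ((q , c) ∈_) (sym (concatMap-pairs (upTo (suc (maxRow D))) (upTo (suc (maxCol D)))))
                           (∈-cartesianProduct⁺ (∈-upTo⁺ (s≤s q≤)) (∈-upTo⁺ (s≤s c≤)))

-- Upper bound

HallIn : Diagram → ℕ → ℕ → Set
HallIn X e c = Hall (movable X c) (hole X c) e

ghosts-NoGhost : ∀ D → NoGhost D → ghosts D ≡ 0
ghosts-NoGhost []      []                = refl
ghosts-NoGhost (x ∷ D) (kind≡ord ∷ rest) rewrite kind≡ord = ghosts-NoGhost D rest

row≤maxRow : ∀ X {x} → x ∈ X → row x ≤ maxRow X
row≤maxRow X x∈ = ≤-foldr-⊔ (map row X) (∈-map⁺ row x∈)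

col≤maxCol : ∀ X {x} → x ∈ X → col x ≤ maxCol X
col≤maxCol X x∈ = ≤-foldr-⊔ (map col X) (∈-map⁺ col x∈)

isSnow-parts : ∀ D e c → isSnow D e c ≡ true → isEmpty D e c ≡ true × any (snowWitness D e c) D ≡ true
isSnow-parts D e c snow with ∧-≡true⁻ {1 ≤ᵇ e} snow
... | _ , rest with ∧-≡true⁻ {1 ≤ᵇ c} rest
...   | _ , rest′ = ∧-≡true⁻ {isEmpty D e c} rest′

isSnow⇒∈positions : ∀ D e c → isSnow D e c ≡ true → (e , c) ∈ positions D
isSnow⇒∈positions D e c snow with any-≡true⁻ (snowWitness D e c) D (proj₂ (isSnow-parts D e c snow))
... | x , x∈ , witness with ∧-≡true⁻ {col x ≡ᵇ c} witness
...   | col≡ , rest =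
  ∈-positions D e c (<⇒≤ (<-≤-trans (<ᵇ⇒<′ (proj₁ (∧-≡true⁻ {e <ᵇ row x} rest))) (row≤maxRow D x∈)))
                    (subst (_≤ maxCol D) (≡ᵇ⇒≡′ col≡) (col≤maxCol D x∈))

module Bounds (D : Diagram) (wf : WellFormed D) (noGhost : NoGhost D) where

  rows-pos : ∀ x → x ∈ D → 1 ≤ row x
  rows-pos x x∈ = proj₁ (All.lookup (proj₁ wf) x∈)

  module Column = ColumnOf D noGhost rows-pos

  unfilled : Diagram → ℕ × ℕ → Bool
  unfilled E (q , c) = isSnow D q c ∧ isEmpty E q c

  remaining : Diagram → ℕ
  remaining E = countᴸ (unfilled E) (positions D)

  record Invariant (E : Diagram) : Set where
    field
      coherent      : Coherent E
      empty⇒empty   : ∀ q c → isEmpty E q c ≡ true → isEmpty D q c ≡ true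
      Hall-stays    : ∀ e c → isEmpty D e c ≡ true → HallIn D e c → isEmpty E e c ≡ true × HallIn E e c
      cols-pos      : ∀ q c k → at E q c ≡ just k → 1 ≤ c
      ghosts+remaining : ghosts E + remaining E ≡ sf D

  module AfterMove (E : Diagram) (I : Invariant E) (r c r̂ : ℕ) (legal : LegalMove E r c r̂) where
    open Invariant I
    open LegalMove legal
    open LegalMoveEffect E r c r̂ legal
    open ColumnMoveHall columnMove

    Untouched : ℕ → ℕ → Set
    Untouched q c′ = c′ ≢ c ⊎ (q ≢ r̂ × q ≢ r)

    isEmpty′-untouched : ∀ q c′ → Untouched q c′ → isEmpty X′ q c′ ≡ isEmpty E q c′
    isEmpty′-untouched q c′ (inj₁ c′≢c)        = cong (maybe (λ _ → false) true) (at′-otherCol q c′ c′≢c)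
    isEmpty′-untouched q c′ (inj₂ (q≢r̂ , q≢r)) =
      cong (maybe (λ _ → false) true) (at-relocate-other E r c r̂ q c′ (inj₁ q≢r) (inj₁ q≢r̂))

    isEmpty′⇒untouched : ∀ q c′ → isEmpty X′ q c′ ≡ true → Untouched q c′
    isEmpty′⇒untouched q c′ empty′ with c′ ≟ c
    ... | no c′≢c = inj₁ c′≢c
    ... | yes refl with q ≟ r | q ≟ r̂
    ...   | yes refl | _        = ⊥-elim (false≢true (at-just⇒¬isEmpty X′ at′-source) empty′)
    ...   | no _     | yes refl = ⊥-elim (false≢true (at-just⇒¬isEmpty X′ at′-target) empty′)
    ...   | no q≢r   | no q≢r̂   = inj₂ (q≢r̂ , q≢r)

    isEmpty′⇒isEmpty : ∀ q c′ → isEmpty X′ q c′ ≡ true → isEmpty E q c′ ≡ true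
    isEmpty′⇒isEmpty q c′ empty′ = trans (sym (isEmpty′-untouched q c′ (isEmpty′⇒untouched q c′ empty′))) empty′

    1≤c : 1 ≤ c
    1≤c = cols-pos r c ord source-ord

    target-emptyD : isEmpty D r̂ c ≡ true
    target-emptyD = empty⇒empty r̂ c (at-nothing⇒isEmpty E target-empty)

    target-snow : isSnow D r̂ c ≡ true
    target-snow = Column.¬Hall⇒isSnow c r̂ 1≤r̂ 1≤c target-emptyD
                    (λ hall → ¬Hall-r̂ (proj₂ (Hall-stays r̂ c target-emptyD hall)))

    Hall-stays′ : ∀ e c′ → isEmpty D e c′ ≡ true → HallIn D e c′ →
                  isEmpty X′ e c′ ≡ true × HallIn X′ e c′
    Hall-stays′ e c′ emptyD hallD with Hall-stays e c′ emptyD hallD | c′ ≟ c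
    ... | empty , hall | no c′≢c =
      trans (isEmpty′-untouched e c′ (inj₁ c′≢c)) empty ,
      Hall-mono e (movable′-⊆ c′ c′≢c) (hole-⊆ c′ c′≢c) hall
    ... | empty , hall | yes refl with e ≟ r̂ | e ≟ r
    ...   | yes refl | _        = ⊥-elim (¬Hall-r̂ hall)
    ...   | no _     | yes refl = ⊥-elim (false≢true (at-just⇒¬isEmpty E source-ord) empty)
    ...   | no e≢r̂   | no e≢r   = trans (isEmpty′-untouched e c (inj₂ (e≢r̂ , e≢r))) empty , hall′
      where
      hall′ : HallIn X′ e c
      hall′ with <-cmp e r̂ | <-cmp r e
      ... | tri< e<r̂ _ _ | _ = Hall-below e e<r̂ hall
      ... | _ | tri< r<e _ _ = Hall-above e r<e hall
      ... | tri≈ _ e≡r̂ _ | _ = ⊥-elim (e≢r̂ e≡r̂)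
      ... | _ | tri≈ _ r≡e _ = ⊥-elim (e≢r (sym r≡e))
      ... | tri> _ _ r̂<e | tri> _ _ e<r = ⊥-elim (false≢true (at-just⇒¬isEmpty E (between-ord e r̂<e e<r)) empty)

    cols-pos′ : ∀ q c′ k → at X′ q c′ ≡ just k → 1 ≤ c′
    cols-pos′ q c′ k at-q with c′ ≟ c
    ... | yes refl = 1≤c
    ... | no c′≢c  = cols-pos q c′ k (trans (sym (at′-otherCol q c′ c′≢c)) at-q)

    remaining-suc : remaining E ≡ suc (remaining X′)
    remaining-suc = countᴸ-remove (unfilled E) (unfilled X′) (positions D) (positions-unique D)
                      (isSnow⇒∈positions D r̂ c target-snow) same filled-before filled-after
      where
      same : ∀ p → p ≢ (r̂ , c) → unfilled E p ≡ unfilled X′ p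
      same (q , c′) p≢ with c′ ≟ c | q ≟ r̂
      ... | yes refl | yes refl = ⊥-elim (p≢ refl)
      ... | no c′≢c  | _        = cong (isSnow D q c′ ∧_) (sym (isEmpty′-untouched q c′ (inj₁ c′≢c)))
      ... | yes refl | no q≢r̂ with q ≟ r
      ...   | yes refl rewrite at-just⇒¬isEmpty E source-ord | at-just⇒¬isEmpty X′ at′-source = refl
      ...   | no q≢r   = cong (isSnow D q c ∧_) (sym (isEmpty′-untouched q c (inj₂ (q≢r̂ , q≢r))))
      filled-before : unfilled E (r̂ , c) ≡ true
      filled-before rewrite target-snow | at-nothing⇒isEmpty E target-empty = refl
      filled-after : unfilled X′ (r̂ , c) ≡ false
      filled-after rewrite at-just⇒¬isEmpty X′ at′-target = ∧-zeroʳ (isSnow D r̂ c)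

    remaining-pred : ∀ {n} → remaining E ≡ suc n → remaining (relocate r c r̂ E) ≡ n
    remaining-pred remaining≡ = suc-injective (trans (sym remaining-suc) remaining≡)

    invariant : Invariant X′
    invariant = record
      { coherent         = Coherent-relocate E r c r̂ coherent (<⇒≢ r̂<r) target-empty
      ; empty⇒empty      = λ q c′ empty′ → empty⇒empty q c′ (isEmpty′⇒isEmpty q c′ empty′)
      ; Hall-stays       = Hall-stays′
      ; cols-pos         = cols-pos′
      ; ghosts+remaining = trans (cong₂ _+_ (ghosts-relocate E r c r̂) refl)
                                 (trans (sym (+-suc (ghosts E) (remaining X′)))
                                        (trans (cong (ghosts E +_) (sym remaining-suc)) ghosts+remaining))
      }

  invariant-ghostMove : ∀ E → Invariant E → ∀ r → Invariant (ghostMove r E)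
  invariant-ghostMove E I r with ghostMove-cases E r (Invariant.coherent I)
  ... | inj₁ unchanged rewrite unchanged = I
  ... | inj₂ (c , r̂ , legal , moved) rewrite moved = AfterMove.invariant E I r c r̂ legal

  invariant-GKD : ∀ E F → Invariant E → GKD E F → Invariant F
  invariant-GKD E .E I ε = I
  invariant-GKD E F I ((r , refl) ◅ moves) = invariant-GKD _ F (invariant-ghostMove E I r) moves

  coherent-D : Coherent D
  coherent-D x x∈ with ∈⇒at-just D x∈ refl refl
  ... | k , at-x with at-just⇒CellAt D at-x
  ...   | y , y∈ , _ , _ , refl rewrite All.lookup noGhost x∈ | All.lookup noGhost y∈ = at-x

  invariant-D : Invariant D
  invariant-D = record
    { coherent         = coherent-D
    ; empty⇒empty      = λ _ _ empty → empty
    ; Hall-stays       = λ _ _ empty hall → empty , hall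
    ; cols-pos         = λ q c k at-q → let x , x∈ , _ , col≡ , _ = at-just⇒CellAt D at-q in
                                        subst (1 ≤_) col≡ (proj₂ (All.lookup (proj₁ wf) x∈))
    ; ghosts+remaining = cong₂ _+_ (ghosts-NoGhost D noGhost) (countᴸ-cong (unfilled D) _ (positions D) unfilled≡snow)
    }
    where
    unfilled≡snow : ∀ p → p ∈ positions D → unfilled D p ≡ isSnow D (proj₁ p) (proj₂ p)
    unfilled≡snow (q , c) _ with isSnow D q c in snow
    ... | true  = proj₁ (isSnow-parts D q c snow)
    ... | false = refl

  ghosts≤sf : ∀ E → GKD D E → ghosts E ≤ sf D
  ghosts≤sf E moves = subst (ghosts E ≤_) (Invariant.ghosts+remaining (invariant-GKD D E invariant-D moves)) (m≤m+n _ _)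

-- Lower bound: the greedy strategy

least : (g : ℕ → Bool) → ∀ n → g n ≡ true → ∃ λ m → g m ≡ true × (∀ k → k < m → g k ≡ false)
least g zero g0 = 0 , g0 , λ _ ()
least g (suc n) gn with g 0 in g0
... | true  = 0 , g0 , λ _ ()
... | false with least (λ i → g (suc i)) n gn
...   | m , gm , below = suc m , gm , λ { zero _ → g0 ; (suc k) (s≤s k<m) → below k k<m }

greatest-in : (g : ℕ → Bool) → ∀ a b →
              (∃ λ q → a ≤ q × q < b × g q ≡ true × (∀ q′ → q < q′ → q′ < b → g q′ ≡ false)) ⊎
              (∀ q → a ≤ q → q < b → g q ≡ false)
greatest-in g a zero = inj₂ (λ _ _ ())
greatest-in g a (suc b) with a ≤? b
... | no a≰b = inj₂ (λ q a≤q q≤b → ⊥-elim (a≰b (≤-trans a≤q (≤-pred q≤b))))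
... | yes a≤b with g b in gb
...   | true  = inj₁ (b , a≤b , ≤-refl , gb , λ q′ b<q′ q′≤b → ⊥-elim (<⇒≱ b<q′ (≤-pred q′≤b)))
...   | false with greatest-in g a b
...     | inj₁ (q , a≤q , q<b , gq , above) = inj₁ (q , a≤q , m<n⇒m<1+n q<b , gq , above′)
  where
  above′ : ∀ q′ → q < q′ → q′ < suc b → g q′ ≡ false
  above′ q′ q<q′ q′≤b with q′ ≟ b
  ... | yes refl = gb
  ... | no q′≢b  = above q′ q<q′ (≤∧≢⇒< (≤-pred q′≤b) q′≢b)
...     | inj₂ none = inj₂ none′
  where
  none′ : ∀ q → a ≤ q → q < suc b → g q ≡ false
  none′ q a≤q q≤b with q ≟ b
  ... | yes refl = gb
  ... | no q≢b   = none q a≤q (≤∧≢⇒< (≤-pred q≤b) q≢b)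

module Greedy (D : Diagram) (wf : WellFormed D) (noGhost : NoGhost D) where
  open Bounds D wf noGhost

  record GreedyInvariant (E : Diagram) : Set where
    field
      unfilled-¬Hall : ∀ e c → isSnow D e c ≡ true → isEmpty E e c ≡ true → ¬ HallIn E e c
      ghost-above-movable : ∀ c g q → at E g c ≡ just ghost → movable E c q ≡ true → q < g

  hasUnfilled : Diagram → ℕ → Bool
  hasUnfilled E c = any (λ p → (proj₂ p ≡ᵇ c) ∧ unfilled E p) (positions D)

  hasUnfilled-intro : ∀ E e c → (e , c) ∈ positions D → unfilled E (e , c) ≡ true → hasUnfilled E c ≡ true
  hasUnfilled-intro E e c p∈ unfilled-p =
    any-≡true⁺ (λ p → (proj₂ p ≡ᵇ c) ∧ unfilled E p) p∈ (∧-≡true⁺ (≡ᵇ-refl c) unfilled-p)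

  -- Only columns left of c* gain blocked rows, so c* must be the leftmost column with an unfilled snowflake;
  -- moving the topmost movable cell keeps Hall's condition failing at the unfilled snowflakes of c*.
  module GreedyMove (E : Diagram) (I : Invariant E) (G : GreedyInvariant E) (c* : ℕ)
                    (leftmost : ∀ c → c < c* → hasUnfilled E c ≡ false)
                    (r r̂ : ℕ) (legal : LegalMove E r c* r̂) (topmost : ∀ q → r < q → movable E c* q ≡ false) where
    open GreedyInvariant G
    open LegalMove legal
    open LegalMoveEffect E r c* r̂ legal
    open ColumnMoveHall columnMove
    open ColumnMove columnMove using (O-r; O′-r; O′-other)
    open AfterMove E I r c* r̂ legal using (Untouched; isEmpty′⇒untouched; isEmpty′⇒isEmpty)

    unfilled-¬Hall′ : ∀ e c → isSnow D e c ≡ true → isEmpty X′ e c ≡ true → ¬ HallIn X′ e c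
    unfilled-¬Hall′ e c snow empty′ with isEmpty′⇒isEmpty e c empty′ | isEmpty′⇒untouched e c empty′ | <-cmp c c*
    ... | empty | _ | tri< c<c* _ _ =
      ⊥-elim (false≢true (leftmost c c<c*)
        (hasUnfilled-intro E e c (isSnow⇒∈positions D e c snow) (∧-≡true⁺ snow empty)))
    ... | empty | _ | tri> _ _ c*<c = λ hall′ →
      unfilled-¬Hall e c snow empty (Hall-cong e (λ q _ → movable′-right c q c*<c) (λ q _ → hole′-right c q c*<c) hall′)
    ... | empty | inj₁ c≢c* | tri≈ _ c≡c* _ = ⊥-elim (c≢c* c≡c*)
    ... | empty | inj₂ (e≢r̂ , e≢r) | tri≈ _ refl _ with <-cmp e r̂ | <-cmp r e
    ...   | tri< e<r̂ _ _ | _ = λ hall′ → unfilled-¬Hall e c snow empty (Hall-below⁻ topmost e e<r̂ hall′)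
    ...   | _ | tri< r<e _ _ =
      ⊥-elim (unfilled-¬Hall e c snow empty (Hall-vacuous _ _ e (λ q e<q → topmost q (<-trans r<e e<q))))
    ...   | tri≈ _ e≡r̂ _ | _ = ⊥-elim (e≢r̂ e≡r̂)
    ...   | _ | tri≈ _ r≡e _ = ⊥-elim (e≢r (sym r≡e))
    ...   | tri> _ _ r̂<e | tri> _ _ e<r = ⊥-elim (false≢true (at-just⇒¬isEmpty E (between-ord e r̂<e e<r)) empty)

    movable-below-r : ∀ q → q ≢ r → movable E c* q ≡ true → q < r
    movable-below-r q q≢r mov with r <? q
    ... | yes r<q = ⊥-elim (false≢true (topmost q r<q) mov)
    ... | no r≮q  = ≤∧≢⇒< (≮⇒≥ r≮q) q≢r

    ghost-above-movable′ : ∀ c g q → at X′ g c ≡ just ghost → movable X′ c q ≡ true → q < g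
    ghost-above-movable′ c g q ghost-g mov′ with c ≟ c*
    ... | no c≢c* = ghost-above-movable c g q (trans (sym (at′-otherCol g c c≢c*)) ghost-g) (movable′-⊆ c c≢c* q mov′)
    ... | yes refl with g ≟ r̂ | q ≟ r | q ≟ r̂
    ...   | yes refl | _ | _ = ⊥-elim (ord≢ghost (trans (sym at′-target) ghost-g))
    ...   | no _ | yes refl | _ = ⊥-elim (false≢true O′-r mov′)
    ...   | no g≢r̂ | no q≢r | yes refl with g ≟ r
    ...     | yes refl = r̂<r
    ...     | no g≢r = <-trans r̂<r (ghost-above-movable c g r (trans (sym (at′-otherRow g g≢r g≢r̂)) ghost-g) O-r)
    ghost-above-movable′ c g q ghost-g mov′ | yes refl | no g≢r̂ | no q≢r | no q≢r̂ with g ≟ r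
    ...     | yes refl = movable-below-r q q≢r (trans (sym (O′-other q q≢r q≢r̂)) mov′)
    ...     | no g≢r =
      ghost-above-movable c g q (trans (sym (at′-otherRow g g≢r g≢r̂)) ghost-g)
                                (trans (sym (O′-other q q≢r q≢r̂)) mov′)

    greedyInvariant′ : GreedyInvariant X′
    greedyInvariant′ = record { unfilled-¬Hall = unfilled-¬Hall′ ; ghost-above-movable = ghost-above-movable′ }

  leftmost-unfilled : ∀ E {n} → remaining E ≡ suc n →
                      ∃ λ c* → (∀ c → c < c* → hasUnfilled E c ≡ false) ×
                               (∃ λ e → isSnow D e c* ≡ true × isEmpty E e c* ≡ true)
  leftmost-unfilled E remaining≡ with countᴸ-suc⇒∃ (unfilled E) (positions D) remaining≡
  ... | (e , c) , p∈ , unfilled-p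
    with least (hasUnfilled E) c (hasUnfilled-intro E e c p∈ unfilled-p)
  ...   | c* , has , leftmost with any-≡true⁻ (λ p → (proj₂ p ≡ᵇ c*) ∧ unfilled E p) (positions D) has
  ...     | (e* , c′) , _ , in-c* with ∧-≡true⁻ {c′ ≡ᵇ c*} in-c*
  ...       | c′≡c* , unfilled-e* rewrite ≡ᵇ⇒≡′ {c′} c′≡c* =
    c* , leftmost , e* , ∧-≡true⁻ {isSnow D e* c*} unfilled-e*

  movable≤maxRow : ∀ E c q → movable E c q ≡ true → q ≤ maxRow E
  movable≤maxRow E c q mov with at-just⇒CellAt E (isOrdinary⇒at-ord E q c (proj₁ (∧-≡true⁻ {isOrdinary E q c} mov)))
  ... | x , x∈ , refl , _ = row≤maxRow E x∈

  topmost-movable : ∀ E c e → ¬ HallIn E e c →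
                    ∃ λ r → e < r × movable E c r ≡ true × (∀ q → r < q → movable E c q ≡ false)
  topmost-movable E c e ¬hall with greatest-in (movable E c) (suc e) (suc (maxRow E))
  ... | inj₂ none = ⊥-elim (¬hall (Hall-vacuous _ _ e (λ q e<q → above-none q e<q)))
    where
    above-none : ∀ q → e < q → movable E c q ≡ false
    above-none q e<q with q ≤? maxRow E
    ... | yes q≤max = none q e<q (s≤s q≤max)
    ... | no q≰max with movable E c q in mov
    ...   | false = refl
    ...   | true  = ⊥-elim (q≰max (movable≤maxRow E c q mov))
  ... | inj₁ (r , e<r , r≤max , mov , above) = r , e<r , mov , topmost
    where
    topmost : ∀ q → r < q → movable E c q ≡ false
    topmost q r<q with q ≤? maxRow E
    ... | yes q≤max = above q r<q (s≤s q≤max)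
    ... | no q≰max with movable E c q in mov-q
    ...   | false = refl
    ...   | true  = ⊥-elim (q≰max (movable≤maxRow E c q mov-q))

  legal-move-down : ∀ E → GreedyInvariant E → ∀ c e r → 1 ≤ e → isEmpty E e c ≡ true → e < r →
                    movable E c r ≡ true → ∃ λ r̂ → LegalMove E r c r̂
  legal-move-down E G c e r 1≤e empty e<r mov with greatest-in (λ q → isEmpty E q c) e r
  ... | inj₂ none = ⊥-elim (false≢true (none e ≤-refl e<r) empty)
  ... | inj₁ (r̂ , e≤r̂ , r̂<r , empty-r̂ , above) = r̂ , record
    { source-ord       = isOrdinary⇒at-ord E r c (proj₁ (∧-≡true⁻ {isOrdinary E r c} mov))
    ; source-unblocked = not-≡true⁻ (proj₂ (∧-≡true⁻ {isOrdinary E r c} mov))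
    ; r̂<r              = r̂<r
    ; 1≤r̂              = ≤-trans 1≤e e≤r̂
    ; target-empty     = isEmpty⇒at-nothing E empty-r̂
    ; between-ord      = between
    }
    where
    between : ∀ q → r̂ < q → q < r → at E q c ≡ just ord
    between q r̂<q q<r with ¬isEmpty⇒at-just E (above q r̂<q q<r)
    ... | ord , at-q   = at-q
    ... | ghost , at-q = ⊥-elim (<⇒≱ q<r (<⇒≤ (GreedyInvariant.ghost-above-movable G c q r at-q mov)))

  Optimal : Diagram → Set
  Optimal E = ∃ λ F → GKD E F × ghosts F ≡ sf D

  greedy : ∀ n E → Invariant E → GreedyInvariant E → remaining E ≡ n → Optimal E
  greedy zero E I _ remaining≡0 =
    E , ε , trans (sym (+-identityʳ _)) (trans (cong (ghosts E +_) (sym remaining≡0)) (Invariant.ghosts+remaining I))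
  greedy (suc n) E I G remaining≡ =
    let c* , leftmost , e , snow , empty = leftmost-unfilled E remaining≡
        r , e<r , mov , topmost = topmost-movable E c* e (GreedyInvariant.unfilled-¬Hall G e c* snow empty)
        r̂ , legal = legal-move-down E G c* e r (proj₁ (Column.isSnow⇒¬Hall c* e snow)) empty e<r mov
        F , moves , ghosts≡ = greedy n (relocate r c* r̂ E) (AfterMove.invariant E I r c* r̂ legal)
                                (GreedyMove.greedyInvariant′ E I G c* leftmost r r̂ legal topmost)
                                (AfterMove.remaining-pred E I r c* r̂ legal remaining≡)
    in F , (r , sym (ghostMove-legal E r c* r̂ (Invariant.coherent I) legal)) ◅ moves , ghosts≡

  greedyInvariant-D : GreedyInvariant D
  greedyInvariant-D = record
    { unfilled-¬Hall      = λ e c snow _ → proj₂ (proj₂ (proj₂ (Column.isSnow⇒¬Hall c e snow)))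
    ; ghost-above-movable = λ c g q ghost-g _ → ⊥-elim (no-ghost (at-just⇒CellAt D ghost-g))
    }
    where
    no-ghost : ∀ {g c} → CellAt D g c ghost → ⊥
    no-ghost (x , x∈ , _ , _ , kind≡ghost) with trans (sym (All.lookup noGhost x∈)) kind≡ghost
    ... | ()

  optimal-D : Optimal D
  optimal-D = greedy (remaining D) D invariant-D greedyInvariant-D refl

theorem4p1 : (D : Diagram) → WellFormed D → NoGhost D → MaxGIs D (sf D)
theorem4p1 D wf noGhost = Greedy.optimal-D D wf noGhost , Bounds.ghosts≤sf D wf noGhost
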